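{- Let $n \geq 2$, $p = \lfloor\frac{n+1}{2}\rfloor$ and $g = am - pc \in \mathrm{OS}_n$. Then $g^p = 0$.
   Context: $\mathrm{OS}_n$ is the quotient of the exterior algebra over $\mathbb{Q}$ on generators $e_{ij}$, $1 \leq i < j \leq n+1$ (each of degree $1$), by the two-sided ideal generated by $e_{ik}e_{jk} - e_{ij}e_{jk} + e_{ij}e_{ik}$ for $1 \leq i<j<k \leq n+1$. Define $a = \sum_{1\leq i<j\leq n} e_{ij}$, $m = \sum_{1 \leq i \leq n} e_{i,n+1}$, and $c = \sum_{1 \leq i<j\leq n}\big(e_{ij}e_{i,n+1} + e_{ij}e_{j,n+1}\big)$ in $\mathrm{OS}_n$. -}

module Defs where

open import Data.Nat as ℕ using (ℕ; zero; suc)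
open import Data.Nat.Properties as ℕP using ()
open import Data.Fin as F using (Fin; toℕ)
open import Data.Fin.Properties using (_<?_)
open import Data.Integer using (+_)
open import Data.Rational using (ℚ; 0ℚ; 1ℚ; -_; _/_) renaming (_+_ to _+ℚ_; _*_ to _*ℚ_)
open import Data.List using (List; []; _∷_; _++_; map; concatMap; allFin; foldr)
open import Data.Maybe using (Maybe; just; nothing)
open import Data.Product using (Σ; _×_; _,_; ∃)
open import Data.Bool using (Bool; true; false; _∧_)
open import Relation.Nullary using (yes; no)
open import Relation.Binary.PropositionalEquality using (_≡_)

-- Generators e_ij of the exterior algebra, 1 ≤ i < j ≤ n+1 (0-based here:
-- i < j in Fin (n+1)).
Gen : ℕ → Set
Gen n = Σ (Fin (suc n) × Fin (suc n)) (λ { (i , j) → i F.< j })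

data Cmp : Set where lt eq gt : Cmp

cmpℕ : ℕ → ℕ → Cmp
cmpℕ zero zero = eq
cmpℕ zero (suc _) = lt
cmpℕ (suc _) zero = gt
cmpℕ (suc a) (suc b) = cmpℕ a b

cmpG : ∀ {n} → Gen n → Gen n → Cmp
cmpG ((i , j) , _) ((k , l) , _) with cmpℕ (toℕ i) (toℕ k)
... | lt = lt
... | gt = gt
... | eq = cmpℕ (toℕ j) (toℕ l)

-- Elements of the tensor (free associative) algebra on the generators over ℚ,
-- as formal ℚ-linear combinations of words.
Word : ℕ → Set
Word n = List (Gen n)

Elem : ℕ → Set
Elem n = List (ℚ × Word n)

-- insert a generator into a strictly increasing word, tracking the sign;
-- nothing if the generator is already present (the product is 0).
insertW : ∀ {n} → Gen n → Word n → Maybe (ℚ × Word n)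
insertW x [] = just (1ℚ , x ∷ [])
insertW x (y ∷ ys) with cmpG x y
... | lt = just (1ℚ , x ∷ y ∷ ys)
... | eq = nothing
... | gt with insertW x ys
...   | nothing = nothing
...   | just (s , zs) = just (- s , y ∷ zs)

-- normal form of a word in the exterior algebra: ± a strictly increasing word, or 0
sortW : ∀ {n} → Word n → Maybe (ℚ × Word n)
sortW [] = just (1ℚ , [])
sortW (x ∷ xs) with sortW xs
... | nothing = nothing
... | just (s , ys) with insertW x ys
...   | nothing = nothing
...   | just (t , zs) = just (s *ℚ t , zs)

eqW : ∀ {n} → Word n → Word n → Bool
eqW [] [] = true
eqW [] (_ ∷ _) = false
eqW (_ ∷ _) [] = false
eqW (x ∷ xs) (y ∷ ys) with cmpG x y
... | eq = eqW xs ys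
... | _ = false

-- coefficient of the (increasing) basis monomial w in the image of u in the exterior algebra
δ : ∀ {n} → Word n → Word n → ℚ
δ u w with sortW u
... | nothing = 0ℚ
... | just (s , v) with eqW v w
...   | true = s
...   | false = 0ℚ

coeff : ∀ {n} → Elem n → Word n → ℚ
coeff x w = foldr (λ { (c , u) acc → c *ℚ δ u w +ℚ acc }) 0ℚ x

_≈E_ : ∀ {n} → Elem n → Elem n → Set
x ≈E y = ∀ w → coeff x w ≡ coeff y w

_⊕_ : ∀ {n} → Elem n → Elem n → Elem n
_⊕_ = _++_

_⊗_ : ∀ {n} → Elem n → Elem n → Elem n
x ⊗ y = concatMap (λ { (c , u) → map (λ { (d , v) → (c *ℚ d , u ++ v) }) y }) x

_·_ : ∀ {n} → ℚ → Elem n → Elem n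
q · x = map (λ { (c , u) → (q *ℚ c , u) }) x

zeroE : ∀ {n} → Elem n
zeroE = []

oneE : ∀ {n} → Elem n
oneE = (1ℚ , []) ∷ []

_^E_ : ∀ {n} → Elem n → ℕ → Elem n
x ^E zero = oneE
x ^E suc k = x ⊗ (x ^E k)

ΣE : ∀ {n} {A : Set} → List A → (A → Elem n) → Elem n
ΣE xs f = foldr (λ a acc → f a ⊕ acc) zeroE xs

-- the generator e_ij (i < j), and 0 if not i < j (never used in that case)
e : ∀ {n} → Fin (suc n) → Fin (suc n) → Elem n
e i j with i <? j
... | yes p = (1ℚ , ((i , j) , p) ∷ []) ∷ []
... | no _ = zeroE

_<ᵇ_ : ℕ → ℕ → Bool
a <ᵇ b = a ℕ.<ᵇ b

when : ∀ {n} → Bool → Elem n → Elem n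
when true x = x
when false _ = zeroE

pairs : ∀ {n} → (Fin (suc n) → Fin (suc n) → Elem n) → Elem n
pairs {n} f = ΣE (allFin (suc n)) λ i → ΣE (allFin (suc n)) λ j → f i j

-- 0-based: indices 1..n become 0..n-1, index n+1 becomes n (= F.fromℕ n)
last : ∀ n → Fin (suc n)
last n = F.fromℕ n

-- a = Σ_{1 ≤ i<j ≤ n} e_ij
aE : ∀ n → Elem n
aE n = pairs λ i j → when ((toℕ i <ᵇ toℕ j) ∧ (toℕ j <ᵇ n)) (e i j)

-- m = Σ_{1 ≤ i ≤ n} e_{i,n+1}
mE : ∀ n → Elem n
mE n = ΣE (allFin (suc n)) λ i → when (toℕ i <ᵇ n) (e i (last n))

-- c = Σ_{1 ≤ i<j ≤ n} (e_ij e_{i,n+1} + e_ij e_{j,n+1})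
cE : ∀ n → Elem n
cE n = pairs λ i j → when ((toℕ i <ᵇ toℕ j) ∧ (toℕ j <ᵇ n))
         ((e i j ⊗ e i (last n)) ⊕ (e i j ⊗ e j (last n)))

pOf : ℕ → ℕ
pOf n = suc n ℕ./ 2

gE : ∀ n → Elem n
gE n = (aE n ⊗ mE n) ⊕ ((- (+ (pOf n) / 1)) · cE n)

RelIx : ℕ → Set
RelIx n = Σ (Fin (suc n) × Fin (suc n) × Fin (suc n))
            (λ { (i , j , k) → (i F.< j) × (j F.< k) })

rel : ∀ {n} → RelIx n → Elem n
rel ((i , j , k) , _) =
  (e i k ⊗ e j k) ⊕ (((- 1ℚ) · (e i j ⊗ e j k)) ⊕ (e i j ⊗ e i k))

-- x lies in the two-sided ideal of the exterior algebra generated by the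
-- Orlik–Solomon relations, i.e. x = 0 in OS_n.
IsZeroOS : ∀ {n} → Elem n → Set
IsZeroOS {n} x = ∃ λ (ts : List (Elem n × RelIx n × Elem n)) →
  x ≈E ΣE ts (λ { (l , r , y) → l ⊗ (rel r ⊗ y) })

{-# OPTIONS --safe #-}
-- Equality in the exterior algebra is tested against alternating functionals on words: x and y
-- are equal there when Σ c·F(u) agrees for every alternating F, which suffices because the
-- coefficient of each normal-form monomial (computed by insertion sort) is such a functional.
--
-- Every word of length > n lies in the Orlik–Solomon ideal. Induct on the largest index k that
-- occurs: two letters e_ik, e_jk (i < j) are traded, by the relation e_ik e_jk = e_ij e_jk − e_ij e_ik,
-- for words with one letter of index k fewer, and a word with a single such letter is that letter
-- times a word of length ≥ k in the indices below k.
--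
-- g has degree 2, so for odd n the power g^p has degree 2p = n + 1 and vanishes. For even n = 2p,
-- let ∂ be the derivation with ∂ e_ij = 1; it maps the ideal into itself since it kills the
-- relations. Counting terms, ∂(am) = (n(n−1)/2) m − n a and ∂c = (n − 1) m − 2a, so ∂g = 0.
-- Hence ∂(g^p) = 0 and g^p = ∂(e g^p) for any generator e, where e g^p has degree n + 1.
module Submission where

open import Defs

open import Algebra.Bundles using (CommutativeRing)
open import Data.Bool using (Bool; true; false; _∧_; if_then_else_; T)
import Data.Bool.Properties as Bool
open import Data.Empty using (⊥-elim)
open import Data.Fin as Fin using (Fin; toℕ)
import Data.Fin.Properties as FinP
import Data.Integer as ℤ
open import Data.List using (List; []; _∷_; _++_; map; length; tabulate; allFin)
import Data.List.Properties as ListP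
open import Data.List.Relation.Unary.All as All using (All; []; _∷_; universal)
import Data.List.Relation.Unary.All.Properties as AllP
open import Data.Maybe using (Maybe; just; nothing)
open import Data.Nat as ℕ using (ℕ; zero; suc; _≤_; _<_; z≤n; s≤s)
import Data.Nat.Coprimality as Coprimality
import Data.Nat.DivMod as DivMod
import Data.Nat.Properties as ℕP
open import Data.Product using (Σ; _×_; _,_; proj₁; proj₂)
open import Data.Rational using (ℚ; 0ℚ; 1ℚ; -_; _/_; _+_; _*_; _-_; mkℚ)
import Data.Rational.Properties as ℚP
open import Data.Sum using (_⊎_; inj₁; inj₂)
open import Data.Unit using (tt)
open import Function.Base using (_∘_)
open import Function.Bundles using (Equivalence)
open import Relation.Binary.Bundles using (Setoid)
open import Relation.Binary.Definitions using (tri<; tri≈; tri>)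
open import Relation.Binary.PropositionalEquality
import Relation.Binary.Reasoning.Setoid as SetoidReasoning
open import Relation.Nullary using (yes; no)
open import Relation.Nullary.Decidable.Core using (dec⇒maybe)
open import Tactic.RingSolver using (solve-∀)
open import Tactic.RingSolver.Core.AlmostCommutativeRing using (AlmostCommutativeRing; fromCommutativeRing)

open import Algebra.Properties.Semiring.Sum (CommutativeRing.semiring ℚP.+-*-commutativeRing)
  using (sum; sum-syntax; ∑-distrib-+; *-distribˡ-sum; *-distribʳ-sum; sum-cong-≗; sum-replicate-zero)
open import Algebra.Properties.Ring (CommutativeRing.ring ℚP.+-*-commutativeRing)
  using (-1*x≈-x; -‿involutive)

-- Rational arithmetic and finite sums

ℚ-ring : AlmostCommutativeRing _ _
ℚ-ring = fromCommutativeRing ℚP.+-*-commutativeRing (λ x → dec⇒maybe (0ℚ ℚP.≟ x))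

fromℕ : ℕ → ℚ
fromℕ k = ℤ.+ k / 1

fromℕ-suc : ∀ k → fromℕ (suc k) ≡ 1ℚ + fromℕ k
fromℕ-suc zero = refl
fromℕ-suc (suc k) = begin
  ℤ.+ suc (suc k) / 1             ≡⟨ cong (λ z → ℤ.+ suc (suc z) / 1) (sym (ℕP.*-identityʳ k)) ⟩
  ℤ.+ suc (suc (k ℕ.* 1)) / 1     ≡⟨⟩
  1ℚ + mkℚ (ℤ.+ suc k) 0 coprime  ≡⟨ cong (1ℚ +_) (sym (ℚP.normalize-coprime coprime)) ⟩
  1ℚ + fromℕ (suc k)              ∎
  where
  open ≡-Reasoning
  coprime = Coprimality.sym (Coprimality.1-coprimeTo (suc k))

fromℕ-+ : ∀ a b → fromℕ (a ℕ.+ b) ≡ fromℕ a + fromℕ b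
fromℕ-+ zero b = sym (ℚP.+-identityˡ (fromℕ b))
fromℕ-+ (suc a) b = begin
  fromℕ (suc (a ℕ.+ b))        ≡⟨ fromℕ-suc (a ℕ.+ b) ⟩
  1ℚ + fromℕ (a ℕ.+ b)         ≡⟨ cong (1ℚ +_) (fromℕ-+ a b) ⟩
  1ℚ + (fromℕ a + fromℕ b)     ≡⟨ sym (ℚP.+-assoc 1ℚ (fromℕ a) (fromℕ b)) ⟩
  (1ℚ + fromℕ a) + fromℕ b     ≡⟨ cong (_+ fromℕ b) (sym (fromℕ-suc a)) ⟩
  fromℕ (suc a) + fromℕ b      ∎
  where open ≡-Reasoning

½ : ℚ
½ = ℤ.+ 1 / 2

p≡½[p+p] : ∀ p → p ≡ ½ * (p + p)
p≡½[p+p] = solve-∀ ℚ-ring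

p≡-p⇒p≡0 : ∀ {p} → p ≡ - p → p ≡ 0ℚ
p≡-p⇒p≡0 {p} p≡-p = begin
  p                    ≡⟨ p≡½[p+p] p ⟩
  ½ * (p + p)          ≡⟨ cong (λ z → ½ * (p + z)) p≡-p ⟩
  ½ * (p + - p)        ≡⟨ cong (½ *_) (ℚP.+-inverseʳ p) ⟩
  ½ * 0ℚ               ≡⟨ ℚP.*-zeroʳ ½ ⟩
  0ℚ                   ∎
  where open ≡-Reasoning

indicator : Bool → ℚ
indicator true = 1ℚ
indicator false = 0ℚ

indicator-cong : ∀ b {x y} → (T b → x ≡ y) → indicator b * x ≡ indicator b * y
indicator-cong true x≡y = cong (1ℚ *_) (x≡y tt)
indicator-cong false {x} {y} _ = trans (ℚP.*-zeroˡ x) (sym (ℚP.*-zeroˡ y))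

below : ∀ {m} → ℕ → Fin m → ℚ
below c a = indicator (toℕ a <ᵇ c)

pairBelow : ∀ {m} → ℕ → Fin m → Fin m → ℚ
pairBelow c a b = indicator ((toℕ a <ᵇ toℕ b) ∧ (toℕ b <ᵇ c))

∑-linear : ∀ {m} α β (f g : Fin m → ℚ) →
  ∑[ a < m ] (α * f a + β * g a) ≡ α * ∑[ a < m ] f a + β * ∑[ a < m ] g a
∑-linear α β f g = trans (∑-distrib-+ (λ a → α * f a) (λ a → β * g a))
                         (cong₂ _+_ (sym (*-distribˡ-sum α f)) (sym (*-distribˡ-sum β g)))

∑∑-linear : ∀ {m} α β (f g : Fin m → Fin m → ℚ) →
  ∑[ a < m ] ∑[ b < m ] (α * f a b + β * g a b)
    ≡ α * ∑[ a < m ] ∑[ b < m ] f a b + β * ∑[ a < m ] ∑[ b < m ] g a b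
∑∑-linear α β f g = trans (sum-cong-≗ (λ a → ∑-linear α β (f a) (g a)))
                          (∑-linear α β (λ a → sum (f a)) (λ a → sum (g a)))

∑-below : ∀ m c → c ≤ m → ∑[ a < m ] below c a ≡ fromℕ c
∑-below m zero _ = sum-replicate-zero m
∑-below (suc m) (suc c) (s≤s c≤m) = trans (cong (1ℚ +_) (∑-below m c c≤m)) (sym (fromℕ-suc c))

∑-pairBelow : ∀ {m} c (ψ : Fin m → ℚ) →
  ∑[ a < m ] ∑[ b < m ] (pairBelow c a b * (ψ a + ψ b))
    ≡ (∑[ a < m ] below c a - 1ℚ) * ∑[ a < m ] (below c a * ψ a)
∑-pairBelow {zero} c ψ = refl
∑-pairBelow {suc m} zero ψ = begin
  ∑[ a < suc m ] ∑[ b < suc m ] (pairBelow 0 a b * (ψ a + ψ b))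
    ≡⟨ sum-cong-≗ (λ a → trans (sum-cong-≗ (λ b → vanish a b)) (sum-replicate-zero (suc m))) ⟩
  ∑[ a < suc m ] 0ℚ
    ≡⟨ sum-replicate-zero (suc m) ⟩
  0ℚ
    ≡⟨ sym (ℚP.*-zeroʳ (0ℚ - 1ℚ)) ⟩
  (0ℚ - 1ℚ) * 0ℚ
    ≡⟨ cong₂ (λ x y → (x - 1ℚ) * y) (sym (sum-replicate-zero (suc m)))
             (sym (trans (sum-cong-≗ (λ a → ℚP.*-zeroˡ (ψ a))) (sum-replicate-zero (suc m)))) ⟩
  (∑[ a < suc m ] below 0 a - 1ℚ) * ∑[ a < suc m ] (below 0 a * ψ a) ∎
  where
  open ≡-Reasoning
  vanish : ∀ a b → pairBelow 0 a b * (ψ a + ψ b) ≡ 0ℚ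
  vanish a b rewrite Bool.∧-zeroʳ (toℕ a <ᵇ toℕ b) = ℚP.*-zeroˡ (ψ a + ψ b)
∑-pairBelow {suc m} (suc c) ψ = begin
  -- peeling off index 0: the pair (0 , b + 1) counts iff b < c, and no pair ends at 0
  (0ℚ * (ψ₀ + ψ₀) + ∑[ b < m ] (below c b * (ψ₀ + ψ′ b)))
    + ∑[ a < m ] (0ℚ * (ψ′ a + ψ₀) + ∑[ b < m ] (pairBelow c a b * (ψ′ a + ψ′ b)))
    ≡⟨ cong₂ (λ x y → (0ℚ * (ψ₀ + ψ₀) + x) + y) pairs-with-0 pairs-without-0 ⟩
  (0ℚ * (ψ₀ + ψ₀) + (ψ₀ * C + S)) + (C - 1ℚ) * S
    ≡⟨ regroup (ψ₀ + ψ₀) ψ₀ C S ⟩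
  ((1ℚ + C) - 1ℚ) * (1ℚ * ψ₀ + S) ∎
  where
  open ≡-Reasoning
  ψ₀ = ψ Fin.zero
  ψ′ = λ a → ψ (Fin.suc a)
  C = ∑[ a < m ] below c a
  S = ∑[ a < m ] (below c a * ψ′ a)
  pairs-with-0 : ∑[ b < m ] (below c b * (ψ₀ + ψ′ b)) ≡ ψ₀ * C + S
  pairs-with-0 = begin
    ∑[ b < m ] (below c b * (ψ₀ + ψ′ b))
      ≡⟨ sum-cong-≗ (λ b → ℚP.*-distribˡ-+ (below c b) ψ₀ (ψ′ b)) ⟩
    ∑[ b < m ] (below c b * ψ₀ + below c b * ψ′ b)
      ≡⟨ ∑-distrib-+ (λ b → below c b * ψ₀) (λ b → below c b * ψ′ b) ⟩
    ∑[ b < m ] (below c b * ψ₀) + S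
      ≡⟨ cong (_+ S) (trans (sym (*-distribʳ-sum ψ₀ (below {m} c))) (ℚP.*-comm C ψ₀)) ⟩
    ψ₀ * C + S ∎
  pairs-without-0 : ∑[ a < m ] (0ℚ * (ψ′ a + ψ₀) + ∑[ b < m ] (pairBelow c a b * (ψ′ a + ψ′ b)))
                    ≡ (C - 1ℚ) * S
  pairs-without-0 = trans (sum-cong-≗ drop-zero) (∑-pairBelow c ψ′)
    where
    drop-zero : ∀ a → 0ℚ * (ψ′ a + ψ₀) + ∑[ b < m ] (pairBelow c a b * (ψ′ a + ψ′ b))
                      ≡ ∑[ b < m ] (pairBelow c a b * (ψ′ a + ψ′ b))
    drop-zero a = trans (cong (_+ row) (ℚP.*-zeroˡ (ψ′ a + ψ₀))) (ℚP.+-identityˡ row)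
      where row = ∑[ b < m ] (pairBelow c a b * (ψ′ a + ψ′ b))
  regroup : ∀ X p C S → (0ℚ * X + (p * C + S)) + (C - 1ℚ) * S ≡ ((1ℚ + C) - 1ℚ) * (1ℚ * p + S)
  regroup = solve-∀ ℚ-ring

-- Insertion sort is alternating

swapCmp : Cmp → Cmp
swapCmp lt = gt
swapCmp eq = eq
swapCmp gt = lt

lexCmp : Cmp → Cmp → Cmp
lexCmp lt _ = lt
lexCmp eq d = d
lexCmp gt _ = gt

cmpℕ-swap : ∀ a b → cmpℕ b a ≡ swapCmp (cmpℕ a b)
cmpℕ-swap zero zero = refl
cmpℕ-swap zero (suc b) = refl
cmpℕ-swap (suc a) zero = refl
cmpℕ-swap (suc a) (suc b) = cmpℕ-swap a b

cmpℕ-eq : ∀ a b → cmpℕ a b ≡ eq → a ≡ b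
cmpℕ-eq zero zero _ = refl
cmpℕ-eq (suc a) (suc b) a≡b = cong suc (cmpℕ-eq a b a≡b)

cmpℕ-trans : ∀ a b c → cmpℕ a b ≡ lt → cmpℕ b c ≡ lt → cmpℕ a c ≡ lt
cmpℕ-trans zero (suc b) (suc c) _ _ = refl
cmpℕ-trans (suc a) (suc b) (suc c) a<b b<c = cmpℕ-trans a b c a<b b<c

data CmpCase (c : Cmp) : Set where
  is-lt : c ≡ lt → CmpCase c
  is-eq : c ≡ eq → CmpCase c
  is-gt : c ≡ gt → CmpCase c

cmpCase : ∀ c → CmpCase c
cmpCase lt = is-lt refl
cmpCase eq = is-eq refl
cmpCase gt = is-gt refl

lexCmp-swap : ∀ c d → lexCmp (swapCmp c) (swapCmp d) ≡ swapCmp (lexCmp c d)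
lexCmp-swap lt d = refl
lexCmp-swap eq d = refl
lexCmp-swap gt d = refl

lexCmp-eq : ∀ c d → lexCmp c d ≡ eq → c ≡ eq × d ≡ eq
lexCmp-eq eq eq _ = refl , refl

lexCmp-lt : ∀ c d → lexCmp c d ≡ lt → c ≡ lt ⊎ (c ≡ eq × d ≡ lt)
lexCmp-lt lt d _ = inj₁ refl
lexCmp-lt eq d d≡lt = inj₂ (refl , d≡lt)

module _ {n : ℕ} where

  lo hi : Gen n → ℕ
  lo ((i , _) , _) = toℕ i
  hi ((_ , j) , _) = toℕ j

  cmpG-lex : ∀ (x y : Gen n) → cmpG x y ≡ lexCmp (cmpℕ (lo x) (lo y)) (cmpℕ (hi x) (hi y))
  cmpG-lex ((i , _) , _) ((k , _) , _) with cmpℕ (toℕ i) (toℕ k)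
  ... | lt = refl
  ... | eq = refl
  ... | gt = refl

  cmpG-swap : ∀ x y → cmpG y x ≡ swapCmp (cmpG x y)
  cmpG-swap x y rewrite cmpG-lex y x | cmpG-lex x y | cmpℕ-swap (lo x) (lo y) | cmpℕ-swap (hi x) (hi y) =
    lexCmp-swap (cmpℕ (lo x) (lo y)) (cmpℕ (hi x) (hi y))

  cmpG-lt⇒gt : ∀ x y → cmpG x y ≡ lt → cmpG y x ≡ gt
  cmpG-lt⇒gt x y x<y = trans (cmpG-swap x y) (cong swapCmp x<y)

  cmpG-gt⇒lt : ∀ x y → cmpG x y ≡ gt → cmpG y x ≡ lt
  cmpG-gt⇒lt x y x>y = trans (cmpG-swap x y) (cong swapCmp x>y)

  cmpG-eq⇒eq : ∀ x y → cmpG x y ≡ eq → cmpG y x ≡ eq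
  cmpG-eq⇒eq x y x≡y = trans (cmpG-swap x y) (cong swapCmp x≡y)

  gen-≡ : ∀ {i j k l : Fin (suc n)} (i<j : i Fin.< j) (k<l : k Fin.< l) →
          toℕ i ≡ toℕ k → toℕ j ≡ toℕ l → _≡_ {A = Gen n} ((i , j) , i<j) ((k , l) , k<l)
  gen-≡ i<j k<l i≡k j≡l with FinP.toℕ-injective i≡k | FinP.toℕ-injective j≡l
  ... | refl | refl = cong (λ p → (_ , p)) (ℕP.<-irrelevant i<j k<l)

  cmpG-eq : ∀ x y → cmpG x y ≡ eq → x ≡ y
  cmpG-eq x@((i , j) , i<j) y@((k , l) , k<l) x≡y
    with lexCmp-eq _ _ (trans (sym (cmpG-lex x y)) x≡y)
  ... | lo≡ , hi≡ = gen-≡ i<j k<l (cmpℕ-eq _ _ lo≡) (cmpℕ-eq _ _ hi≡)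

  cmpG-trans : ∀ x y z → cmpG x y ≡ lt → cmpG y z ≡ lt → cmpG x z ≡ lt
  cmpG-trans x y z x<y y<z rewrite cmpG-lex x z
    with lexCmp-lt _ _ (trans (sym (cmpG-lex x y)) x<y) | lexCmp-lt _ _ (trans (sym (cmpG-lex y z)) y<z)
  ... | inj₁ lo< | inj₁ lo<′ rewrite cmpℕ-trans (lo x) (lo y) (lo z) lo< lo<′ = refl
  ... | inj₁ lo< | inj₂ (lo≡ , _) rewrite sym (cmpℕ-eq (lo y) (lo z) lo≡) | lo< = refl
  ... | inj₂ (lo≡ , _) | inj₁ lo< rewrite cmpℕ-eq (lo x) (lo y) lo≡ | lo< = refl
  ... | inj₂ (lo≡ , hi<) | inj₂ (lo≡′ , hi<′)
    rewrite cmpℕ-eq (lo x) (lo y) lo≡ | lo≡′ = cmpℕ-trans (hi x) (hi y) (hi z) hi< hi<′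

  SignedWord : Set
  SignedWord = Maybe (ℚ × Word n)

  negate : SignedWord → SignedWord
  negate nothing = nothing
  negate (just (s , w)) = just (- s , w)

  scale : ℚ → SignedWord → SignedWord
  scale s nothing = nothing
  scale s (just (t , w)) = just (s * t , w)

  shift : Gen n → SignedWord → SignedWord
  shift y nothing = nothing
  shift y (just (t , w)) = just (- t , y ∷ w)

  insertS : Gen n → SignedWord → SignedWord
  insertS x nothing = nothing
  insertS x (just (s , w)) = scale s (insertW x w)

  sortW-∷ : ∀ x w → sortW (x ∷ w) ≡ insertS x (sortW w)
  sortW-∷ x w with sortW w
  ... | nothing = refl
  ... | just (s , ys) with insertW x ys
  ...   | nothing = refl
  ...   | just _ = refl

  insertW-lt : ∀ (x y : Gen n) ys → cmpG x y ≡ lt → insertW x (y ∷ ys) ≡ just (1ℚ , x ∷ y ∷ ys)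
  insertW-lt x y ys x<y rewrite x<y = refl

  insertW-eq : ∀ (x y : Gen n) ys → cmpG x y ≡ eq → insertW x (y ∷ ys) ≡ nothing
  insertW-eq x y ys x≡y rewrite x≡y = refl

  insertW-gt : ∀ (x y : Gen n) ys → cmpG x y ≡ gt → insertW x (y ∷ ys) ≡ shift y (insertW x ys)
  insertW-gt x y ys x>y rewrite x>y with insertW x ys
  ... | nothing = refl
  ... | just _ = refl

  push : Gen n → SignedWord → SignedWord
  push y nothing = nothing
  push y (just (t , w)) = just (t , y ∷ w)

  push-negate : ∀ y r → push y (negate r) ≡ negate (push y r)
  push-negate y nothing = refl
  push-negate y (just _) = refl

  insertS-shift : ∀ x y r → cmpG x y ≡ gt → insertS x (shift y r) ≡ push y (insertS x r)
  insertS-shift x y nothing _ = refl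
  insertS-shift x y (just (t , w)) x>y rewrite insertW-gt x y w x>y with insertW x w
  ... | nothing = refl
  ... | just (u , v) = cong (λ q → just (q , y ∷ v)) (ring t u)
    where
    ring : ∀ t u → - t * - u ≡ t * u
    ring = solve-∀ ℚ-ring

  negate-involutive : ∀ r → negate (negate r) ≡ r
  negate-involutive nothing = refl
  negate-involutive (just (s , w)) = cong (λ q → just (q , w)) (-‿involutive s)

  InsertionsAnticommute : Gen n → Gen n → Word n → Set
  InsertionsAnticommute a b ys = insertS a (insertW b ys) ≡ negate (insertS b (insertW a ys))

  anticommute-sym : ∀ a b ys → InsertionsAnticommute b a ys → InsertionsAnticommute a b ys
  anticommute-sym a b ys ba = trans (sym (negate-involutive _)) (cong negate (sym ba))

  anticommute-< : ∀ a b y ys → cmpG a y ≡ lt → InsertionsAnticommute a b (y ∷ ys)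
  anticommute-< a b y ys a<y with cmpCase (cmpG b y)
  ... | is-lt b<y rewrite insertW-lt a y ys a<y | insertW-lt b y ys b<y with cmpCase (cmpG a b)
  ...   | is-lt a<b rewrite insertW-lt a b (y ∷ ys) a<b | insertW-gt b a (y ∷ ys) (cmpG-lt⇒gt a b a<b)
                          | insertW-lt b y ys b<y = refl
  ...   | is-eq a≡b rewrite insertW-eq a b (y ∷ ys) a≡b | insertW-eq b a (y ∷ ys) (cmpG-eq⇒eq a b a≡b) = refl
  ...   | is-gt a>b rewrite insertW-gt a b (y ∷ ys) a>b | insertW-lt b a (y ∷ ys) (cmpG-gt⇒lt a b a>b)
                          | insertW-lt a y ys a<y = refl
  anticommute-< a b y ys a<y | is-eq b≡y
    rewrite insertW-lt a y ys a<y | insertW-eq b y ys b≡y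
          | insertW-gt b a (y ∷ ys) (cmpG-lt⇒gt a b (subst (λ z → cmpG a z ≡ lt) (sym (cmpG-eq b y b≡y)) a<y))
          | insertW-eq b y ys b≡y = refl
  anticommute-< a b y ys a<y | is-gt b>y
    rewrite insertW-lt a y ys a<y | insertW-gt b y ys b>y
          | insertW-gt b a (y ∷ ys) (cmpG-lt⇒gt a b (cmpG-trans a y b a<y (cmpG-gt⇒lt b y b>y)))
          | insertW-gt b y ys b>y with insertW b ys
  ... | nothing = refl
  ... | just (t , zs) rewrite insertW-lt a y zs a<y = cong (λ q → just (q , a ∷ y ∷ zs)) (ring t)
    where
    ring : ∀ t → - t * 1ℚ ≡ - (1ℚ * - (- t))
    ring = solve-∀ ℚ-ring

  anticommute-≡ : ∀ a b y ys → cmpG a y ≡ eq → InsertionsAnticommute a b (y ∷ ys)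
  anticommute-≡ a b y ys a≡y with cmpCase (cmpG b y)
  ... | is-lt b<y = anticommute-sym a b (y ∷ ys) (anticommute-< b a y ys b<y)
  ... | is-eq b≡y rewrite insertW-eq a y ys a≡y | insertW-eq b y ys b≡y = refl
  ... | is-gt b>y rewrite insertW-eq a y ys a≡y | insertW-gt b y ys b>y with insertW b ys
  ...   | nothing = refl
  ...   | just (t , zs) rewrite insertW-eq a y zs a≡y = refl

  insertW-anticommute : ∀ a b ys → InsertionsAnticommute a b ys
  insertW-anticommute a b [] rewrite cmpG-swap a b with cmpG a b
  ... | lt = refl
  ... | eq = refl
  ... | gt = refl
  insertW-anticommute a b (y ∷ ys) with cmpCase (cmpG a y) | cmpCase (cmpG b y)
  ... | is-lt a<y | _ = anticommute-< a b y ys a<y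
  ... | is-eq a≡y | _ = anticommute-≡ a b y ys a≡y
  ... | is-gt _ | is-lt b<y = anticommute-sym a b (y ∷ ys) (anticommute-< b a y ys b<y)
  ... | is-gt _ | is-eq b≡y = anticommute-sym a b (y ∷ ys) (anticommute-≡ b a y ys b≡y)
  ... | is-gt a>y | is-gt b>y
    rewrite insertW-gt b y ys b>y | insertW-gt a y ys a>y
          | insertS-shift a y (insertW b ys) a>y | insertS-shift b y (insertW a ys) b>y
          | insertW-anticommute a b ys = push-negate y (insertS b (insertW a ys))

  scale-negate : ∀ s r → scale s (negate r) ≡ negate (scale s r)
  scale-negate s nothing = refl
  scale-negate s (just (t , w)) = cong (λ q → just (q , w)) (sym (ℚP.neg-distribʳ-* s t))

  insertS-scale : ∀ x s r → insertS x (scale s r) ≡ scale s (insertS x r)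
  insertS-scale x s nothing = refl
  insertS-scale x s (just (t , w)) with insertW x w
  ... | nothing = refl
  ... | just (u , v) = cong (λ q → just (q , v)) (ℚP.*-assoc s t u)

  insertS-negate : ∀ x r → insertS x (negate r) ≡ negate (insertS x r)
  insertS-negate x nothing = refl
  insertS-negate x (just (s , w)) with insertW x w
  ... | nothing = refl
  ... | just (t , v) = cong (λ q → just (q , v)) (sym (ℚP.neg-distribˡ-* s t))

  insertS-anticommute : ∀ a b r → insertS a (insertS b r) ≡ negate (insertS b (insertS a r))
  insertS-anticommute a b nothing = refl
  insertS-anticommute a b (just (s , w)) = begin
    insertS a (scale s (insertW b w))            ≡⟨ insertS-scale a s (insertW b w) ⟩
    scale s (insertS a (insertW b w))            ≡⟨ cong (scale s) (insertW-anticommute a b w) ⟩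
    scale s (negate (insertS b (insertW a w)))   ≡⟨ scale-negate s (insertS b (insertW a w)) ⟩
    negate (scale s (insertS b (insertW a w)))   ≡⟨ cong negate (sym (insertS-scale b s (insertW a w))) ⟩
    negate (insertS b (scale s (insertW a w)))   ∎
    where open ≡-Reasoning

  sortW-swap : ∀ u a b v → sortW (u ++ a ∷ b ∷ v) ≡ negate (sortW (u ++ b ∷ a ∷ v))
  sortW-swap [] a b v = begin
    sortW (a ∷ b ∷ v)                        ≡⟨ sortW-∷∷ a b v ⟩
    insertS a (insertS b (sortW v))          ≡⟨ insertS-anticommute a b (sortW v) ⟩
    negate (insertS b (insertS a (sortW v))) ≡⟨ cong negate (sym (sortW-∷∷ b a v)) ⟩
    negate (sortW (b ∷ a ∷ v))               ∎
    where
    open ≡-Reasoning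
    sortW-∷∷ : ∀ a b v → sortW (a ∷ b ∷ v) ≡ insertS a (insertS b (sortW v))
    sortW-∷∷ a b v = trans (sortW-∷ a (b ∷ v)) (cong (insertS a) (sortW-∷ b v))
  sortW-swap (x ∷ u) a b v = begin
    sortW (x ∷ u ++ a ∷ b ∷ v)                 ≡⟨ sortW-∷ x (u ++ a ∷ b ∷ v) ⟩
    insertS x (sortW (u ++ a ∷ b ∷ v))         ≡⟨ cong (insertS x) (sortW-swap u a b v) ⟩
    insertS x (negate (sortW (u ++ b ∷ a ∷ v))) ≡⟨ insertS-negate x (sortW (u ++ b ∷ a ∷ v)) ⟩
    negate (insertS x (sortW (u ++ b ∷ a ∷ v))) ≡⟨ cong negate (sym (sortW-∷ x (u ++ b ∷ a ∷ v))) ⟩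
    negate (sortW (x ∷ u ++ b ∷ a ∷ v))        ∎
    where open ≡-Reasoning

  record Alternating (F : Word n → ℚ) : Set where
    constructor alternating
    field swap-adjacent : ∀ u a b v → F (u ++ a ∷ b ∷ v) ≡ - F (u ++ b ∷ a ∷ v)
  open Alternating public

  coefficient : SignedWord → Word n → ℚ
  coefficient nothing w = 0ℚ
  coefficient (just (s , v)) w = if eqW v w then s else 0ℚ

  δ-sortW : ∀ u w → δ u w ≡ coefficient (sortW u) w
  δ-sortW u w with sortW u
  ... | nothing = refl
  ... | just (s , v) with eqW v w
  ...   | true = refl
  ...   | false = refl

  coefficient-negate : ∀ r w → coefficient (negate r) w ≡ - coefficient r w
  coefficient-negate nothing w = refl
  coefficient-negate (just (s , v)) w with eqW v w
  ... | true = refl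
  ... | false = refl

  δ-alternating : ∀ w → Alternating (λ u → δ u w)
  δ-alternating w = alternating λ u a b v → begin
    δ (u ++ a ∷ b ∷ v) w                            ≡⟨ δ-sortW (u ++ a ∷ b ∷ v) w ⟩
    coefficient (sortW (u ++ a ∷ b ∷ v)) w          ≡⟨ cong (λ r → coefficient r w) (sortW-swap u a b v) ⟩
    coefficient (negate (sortW (u ++ b ∷ a ∷ v))) w ≡⟨ coefficient-negate (sortW (u ++ b ∷ a ∷ v)) w ⟩
    - coefficient (sortW (u ++ b ∷ a ∷ v)) w        ≡⟨ cong -_ (sym (δ-sortW (u ++ b ∷ a ∷ v) w)) ⟩
    - δ (u ++ b ∷ a ∷ v) w                          ∎
    where open ≡-Reasoning

pOf-suc-suc : ∀ n → pOf (suc (suc n)) ≡ suc (pOf n)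
pOf-suc-suc n = DivMod.m/n≡1+[m∸n]/n {suc (suc (suc n))} {2} (s≤s (s≤s z≤n))

pOf-parity : ∀ n → n ≡ pOf n ℕ.+ pOf n ⊎ suc n ≡ pOf n ℕ.+ pOf n
pOf-parity zero = inj₁ refl
pOf-parity (suc zero) = inj₂ refl
pOf-parity (suc (suc n)) rewrite pOf-suc-suc n | ℕP.+-suc (pOf n) (pOf n) with pOf-parity n
... | inj₁ even = inj₁ (cong (suc ∘ suc) even)
... | inj₂ odd = inj₂ (cong (suc ∘ suc) odd)

module OrlikSolomon (n : ℕ) where

  -- Pairing with functionals on words, and equality in the exterior algebra

  ⟦_⟧ : Elem n → (Word n → ℚ) → ℚ
  ⟦ [] ⟧ F = 0ℚ
  ⟦ (c , u) ∷ x ⟧ F = c * F u + ⟦ x ⟧ F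

  ⟦⟧-cong : ∀ x {F H : Word n → ℚ} → (∀ u → F u ≡ H u) → ⟦ x ⟧ F ≡ ⟦ x ⟧ H
  ⟦⟧-cong [] F≗H = refl
  ⟦⟧-cong ((c , u) ∷ x) F≗H = cong₂ (λ a b → c * a + b) (F≗H u) (⟦⟧-cong x F≗H)

  ⟦⟧-⊕ : ∀ x y F → ⟦ x ⊕ y ⟧ F ≡ ⟦ x ⟧ F + ⟦ y ⟧ F
  ⟦⟧-⊕ [] y F = sym (ℚP.+-identityˡ (⟦ y ⟧ F))
  ⟦⟧-⊕ ((c , u) ∷ x) y F = trans (cong (λ z → c * F u + z) (⟦⟧-⊕ x y F))
                                  (sym (ℚP.+-assoc (c * F u) (⟦ x ⟧ F) (⟦ y ⟧ F)))

  ⟦⟧-· : ∀ q x F → ⟦ q · x ⟧ F ≡ q * ⟦ x ⟧ F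
  ⟦⟧-· q [] F = sym (ℚP.*-zeroʳ q)
  ⟦⟧-· q ((c , u) ∷ x) F = trans (cong (λ z → (q * c) * F u + z) (⟦⟧-· q x F)) (ring q c (F u) (⟦ x ⟧ F))
    where
    ring : ∀ q c a x → (q * c) * a + q * x ≡ q * (c * a + x)
    ring = solve-∀ ℚ-ring

  ⟦⟧-0 : ∀ x → ⟦ x ⟧ (λ _ → 0ℚ) ≡ 0ℚ
  ⟦⟧-0 [] = refl
  ⟦⟧-0 ((c , u) ∷ x) = trans (cong (λ z → c * 0ℚ + z) (⟦⟧-0 x)) (ring c)
    where
    ring : ∀ c → c * 0ℚ + 0ℚ ≡ 0ℚ
    ring = solve-∀ ℚ-ring

  ⟦⟧-+ : ∀ x (F H : Word n → ℚ) → ⟦ x ⟧ (λ u → F u + H u) ≡ ⟦ x ⟧ F + ⟦ x ⟧ H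
  ⟦⟧-+ [] F H = sym (ℚP.+-identityˡ 0ℚ)
  ⟦⟧-+ ((c , u) ∷ x) F H =
    trans (cong (λ z → c * (F u + H u) + z) (⟦⟧-+ x F H)) (ring c (F u) (H u) (⟦ x ⟧ F) (⟦ x ⟧ H))
    where
    ring : ∀ c a b x y → c * (a + b) + (x + y) ≡ (c * a + x) + (c * b + y)
    ring = solve-∀ ℚ-ring

  ⟦⟧-* : ∀ x q (F : Word n → ℚ) → ⟦ x ⟧ (λ u → q * F u) ≡ q * ⟦ x ⟧ F
  ⟦⟧-* [] q F = sym (ℚP.*-zeroʳ q)
  ⟦⟧-* ((c , u) ∷ x) q F = trans (cong (λ z → c * (q * F u) + z) (⟦⟧-* x q F)) (ring c q (F u) (⟦ x ⟧ F))
    where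
    ring : ∀ c q a x → c * (q * a) + q * x ≡ q * (c * a + x)
    ring = solve-∀ ℚ-ring

  ⟦⟧-neg : ∀ x (F : Word n → ℚ) → ⟦ x ⟧ (λ u → - F u) ≡ - ⟦ x ⟧ F
  ⟦⟧-neg x F = begin
    ⟦ x ⟧ (λ u → - F u)       ≡⟨ ⟦⟧-cong x (λ u → sym (-1*x≈-x (F u))) ⟩
    ⟦ x ⟧ (λ u → - 1ℚ * F u)  ≡⟨ ⟦⟧-* x (- 1ℚ) F ⟩
    - 1ℚ * ⟦ x ⟧ F            ≡⟨ -1*x≈-x (⟦ x ⟧ F) ⟩
    - ⟦ x ⟧ F                 ∎
    where open ≡-Reasoning

  ⟦⟧-swap : ∀ x y (F : Word n → Word n → ℚ) →
    ⟦ x ⟧ (λ u → ⟦ y ⟧ (F u)) ≡ ⟦ y ⟧ (λ v → ⟦ x ⟧ (λ u → F u v))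
  ⟦⟧-swap [] y F = sym (⟦⟧-0 y)
  ⟦⟧-swap ((c , u) ∷ x) y F = begin
    c * ⟦ y ⟧ (F u) + ⟦ x ⟧ (λ u′ → ⟦ y ⟧ (F u′))
      ≡⟨ cong₂ _+_ (sym (⟦⟧-* y c (F u))) (⟦⟧-swap x y F) ⟩
    ⟦ y ⟧ (λ v → c * F u v) + ⟦ y ⟧ (λ v → ⟦ x ⟧ (λ u′ → F u′ v))
      ≡⟨ sym (⟦⟧-+ y _ _) ⟩
    ⟦ y ⟧ (λ v → c * F u v + ⟦ x ⟧ (λ u′ → F u′ v)) ∎
    where open ≡-Reasoning

  ⟦⟧-⊗ : ∀ x y F → ⟦ x ⊗ y ⟧ F ≡ ⟦ x ⟧ (λ u → ⟦ y ⟧ (λ v → F (u ++ v)))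
  ⟦⟧-⊗ [] y F = refl
  ⟦⟧-⊗ ((c , u) ∷ x) y F = begin
    ⟦ map (λ { (d , v) → (c * d , u ++ v) }) y ++ x ⊗ y ⟧ F
      ≡⟨ ⟦⟧-⊕ (map (λ { (d , v) → (c * d , u ++ v) }) y) (x ⊗ y) F ⟩
    ⟦ map (λ { (d , v) → (c * d , u ++ v) }) y ⟧ F + ⟦ x ⊗ y ⟧ F
      ≡⟨ cong₂ _+_ (prefix y) (⟦⟧-⊗ x y F) ⟩
    c * ⟦ y ⟧ (λ v → F (u ++ v)) + ⟦ x ⟧ (λ u′ → ⟦ y ⟧ (λ v → F (u′ ++ v))) ∎
    where
    open ≡-Reasoning
    prefix : ∀ y → ⟦ map (λ { (d , v) → (c * d , u ++ v) }) y ⟧ F ≡ c * ⟦ y ⟧ (λ v → F (u ++ v))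
    prefix [] = sym (ℚP.*-zeroʳ c)
    prefix ((d , v) ∷ y) =
      trans (cong (λ z → (c * d) * F (u ++ v) + z) (prefix y)) (ring c d (F (u ++ v)) (⟦ y ⟧ (λ v → F (u ++ v))))
      where
      ring : ∀ q c a x → (q * c) * a + q * x ≡ q * (c * a + x)
      ring = solve-∀ ℚ-ring

  Alternating-suffix : ∀ {F : Word n → ℚ} u → Alternating F → Alternating (λ v → F (u ++ v))
  Alternating-suffix {F} u alt = alternating λ u′ a b v → begin
    F (u ++ u′ ++ a ∷ b ∷ v)       ≡⟨ cong F (sym (ListP.++-assoc u u′ (a ∷ b ∷ v))) ⟩
    F ((u ++ u′) ++ a ∷ b ∷ v)     ≡⟨ swap-adjacent alt (u ++ u′) a b v ⟩
    - F ((u ++ u′) ++ b ∷ a ∷ v)   ≡⟨ cong (λ w → - F w) (ListP.++-assoc u u′ (b ∷ a ∷ v)) ⟩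
    - F (u ++ u′ ++ b ∷ a ∷ v)     ∎
    where open ≡-Reasoning

  Alternating-prefix : ∀ {F : Word n → ℚ} y → Alternating F →
                       Alternating (λ u → ⟦ y ⟧ (λ v → F (u ++ v)))
  Alternating-prefix {F} y alt = alternating λ u a b w → begin
    ⟦ y ⟧ (λ v → F ((u ++ a ∷ b ∷ w) ++ v))     ≡⟨ ⟦⟧-cong y (swap u a b w) ⟩
    ⟦ y ⟧ (λ v → - F ((u ++ b ∷ a ∷ w) ++ v))   ≡⟨ ⟦⟧-neg y (λ v → F ((u ++ b ∷ a ∷ w) ++ v)) ⟩
    - ⟦ y ⟧ (λ v → F ((u ++ b ∷ a ∷ w) ++ v))   ∎
    where
    open ≡-Reasoning
    swap : ∀ u a b w v → F ((u ++ a ∷ b ∷ w) ++ v) ≡ - F ((u ++ b ∷ a ∷ w) ++ v)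
    swap u a b w v = begin
      F ((u ++ a ∷ b ∷ w) ++ v)   ≡⟨ cong F (ListP.++-assoc u (a ∷ b ∷ w) v) ⟩
      F (u ++ a ∷ b ∷ w ++ v)     ≡⟨ swap-adjacent alt u a b (w ++ v) ⟩
      - F (u ++ b ∷ a ∷ w ++ v)   ≡⟨ cong (λ z → - F z) (sym (ListP.++-assoc u (b ∷ a ∷ w) v)) ⟩
      - F ((u ++ b ∷ a ∷ w) ++ v) ∎

  infix 4 _≈_
  record _≈_ (x y : Elem n) : Set where
    constructor mk≈
    field agree : ∀ F → Alternating F → ⟦ x ⟧ F ≡ ⟦ y ⟧ F
  open _≈_

  free⇒≈ : ∀ {x y} → (∀ F → ⟦ x ⟧ F ≡ ⟦ y ⟧ F) → x ≈ y
  free⇒≈ x≡y = mk≈ λ F _ → x≡y F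

  ≈-setoid : Setoid _ _
  ≈-setoid = record
    { Carrier = Elem n
    ; _≈_ = _≈_
    ; isEquivalence = record
      { refl = mk≈ λ _ _ → refl
      ; sym = λ x≈y → mk≈ λ F alt → sym (agree x≈y F alt)
      ; trans = λ x≈y y≈z → mk≈ λ F alt → trans (agree x≈y F alt) (agree y≈z F alt)
      }
    }

  open Setoid ≈-setoid public using ()
    renaming (refl to ≈-refl; sym to ≈-sym; trans to ≈-trans; reflexive to ≈-reflexive)
  module ≈-Reasoning = SetoidReasoning ≈-setoid

  ≈⇒≈E : ∀ {x y} → x ≈ y → x ≈E y
  ≈⇒≈E {x} {y} x≈y w = begin
    coeff x w                ≡⟨ coeff-⟦⟧ x ⟩
    ⟦ x ⟧ (λ u → δ u w)      ≡⟨ agree x≈y (λ u → δ u w) (δ-alternating w) ⟩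
    ⟦ y ⟧ (λ u → δ u w)      ≡⟨ sym (coeff-⟦⟧ y) ⟩
    coeff y w                ∎
    where
    open ≡-Reasoning
    coeff-⟦⟧ : ∀ x → coeff x w ≡ ⟦ x ⟧ (λ u → δ u w)
    coeff-⟦⟧ [] = refl
    coeff-⟦⟧ ((c , u) ∷ x) = cong (λ z → c * δ u w + z) (coeff-⟦⟧ x)

  ⊕-cong : ∀ {x x′ y y′} → x ≈ x′ → y ≈ y′ → x ⊕ y ≈ x′ ⊕ y′
  ⊕-cong {x} {x′} {y} {y′} x≈x′ y≈y′ = mk≈ λ F alt → begin
    ⟦ x ⊕ y ⟧ F          ≡⟨ ⟦⟧-⊕ x y F ⟩
    ⟦ x ⟧ F + ⟦ y ⟧ F    ≡⟨ cong₂ _+_ (agree x≈x′ F alt) (agree y≈y′ F alt) ⟩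
    ⟦ x′ ⟧ F + ⟦ y′ ⟧ F  ≡⟨ sym (⟦⟧-⊕ x′ y′ F) ⟩
    ⟦ x′ ⊕ y′ ⟧ F        ∎
    where open ≡-Reasoning

  ·-cong : ∀ q {x y} → x ≈ y → q · x ≈ q · y
  ·-cong q {x} {y} x≈y = mk≈ λ F alt →
    trans (⟦⟧-· q x F) (trans (cong (q *_) (agree x≈y F alt)) (sym (⟦⟧-· q y F)))

  ⊗-congˡ : ∀ z {x y} → x ≈ y → z ⊗ x ≈ z ⊗ y
  ⊗-congˡ z {x} {y} x≈y = mk≈ λ F alt → begin
    ⟦ z ⊗ x ⟧ F                             ≡⟨ ⟦⟧-⊗ z x F ⟩
    ⟦ z ⟧ (λ u → ⟦ x ⟧ (λ v → F (u ++ v)))  ≡⟨ ⟦⟧-cong z (λ u → agree x≈y _ (Alternating-suffix u alt)) ⟩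
    ⟦ z ⟧ (λ u → ⟦ y ⟧ (λ v → F (u ++ v)))  ≡⟨ sym (⟦⟧-⊗ z y F) ⟩
    ⟦ z ⊗ y ⟧ F                             ∎
    where open ≡-Reasoning

  ⊗-congʳ : ∀ z {x y} → x ≈ y → x ⊗ z ≈ y ⊗ z
  ⊗-congʳ z {x} {y} x≈y = mk≈ λ F alt → begin
    ⟦ x ⊗ z ⟧ F                             ≡⟨ ⟦⟧-⊗ x z F ⟩
    ⟦ x ⟧ (λ u → ⟦ z ⟧ (λ v → F (u ++ v)))  ≡⟨ agree x≈y _ (Alternating-prefix z alt) ⟩
    ⟦ y ⟧ (λ u → ⟦ z ⟧ (λ v → F (u ++ v)))  ≡⟨ sym (⟦⟧-⊗ y z F) ⟩
    ⟦ y ⊗ z ⟧ F                             ∎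
    where open ≡-Reasoning

  ⊗-assoc : ∀ x y z → (x ⊗ y) ⊗ z ≈ x ⊗ (y ⊗ z)
  ⊗-assoc x y z = free⇒≈ λ F → begin
    ⟦ (x ⊗ y) ⊗ z ⟧ F
      ≡⟨ trans (⟦⟧-⊗ (x ⊗ y) z F) (⟦⟧-⊗ x y _) ⟩
    ⟦ x ⟧ (λ u → ⟦ y ⟧ (λ v → ⟦ z ⟧ (λ t → F ((u ++ v) ++ t))))
      ≡⟨ ⟦⟧-cong x (λ u → ⟦⟧-cong y (λ v → ⟦⟧-cong z (λ t → cong F (ListP.++-assoc u v t)))) ⟩
    ⟦ x ⟧ (λ u → ⟦ y ⟧ (λ v → ⟦ z ⟧ (λ t → F (u ++ v ++ t))))
      ≡⟨ sym (trans (⟦⟧-⊗ x (y ⊗ z) F) (⟦⟧-cong x (λ u → ⟦⟧-⊗ y z (λ w → F (u ++ w))))) ⟩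
    ⟦ x ⊗ (y ⊗ z) ⟧ F ∎
    where open ≡-Reasoning

  ⊗-distribˡ-⊕ : ∀ z x y → z ⊗ (x ⊕ y) ≈ (z ⊗ x) ⊕ (z ⊗ y)
  ⊗-distribˡ-⊕ z x y = free⇒≈ λ F → begin
    ⟦ z ⊗ (x ⊕ y) ⟧ F
      ≡⟨ trans (⟦⟧-⊗ z (x ⊕ y) F) (⟦⟧-cong z (λ u → ⟦⟧-⊕ x y _)) ⟩
    ⟦ z ⟧ (λ u → ⟦ x ⟧ (λ v → F (u ++ v)) + ⟦ y ⟧ (λ v → F (u ++ v)))
      ≡⟨ ⟦⟧-+ z _ _ ⟩
    ⟦ z ⟧ (λ u → ⟦ x ⟧ (λ v → F (u ++ v))) + ⟦ z ⟧ (λ u → ⟦ y ⟧ (λ v → F (u ++ v)))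
      ≡⟨ sym (trans (⟦⟧-⊕ (z ⊗ x) (z ⊗ y) F) (cong₂ _+_ (⟦⟧-⊗ z x F) (⟦⟧-⊗ z y F))) ⟩
    ⟦ (z ⊗ x) ⊕ (z ⊗ y) ⟧ F ∎
    where open ≡-Reasoning

  ⊗-distribʳ-⊕ : ∀ z x y → (x ⊕ y) ⊗ z ≈ (x ⊗ z) ⊕ (y ⊗ z)
  ⊗-distribʳ-⊕ z x y = free⇒≈ λ F → begin
    ⟦ (x ⊕ y) ⊗ z ⟧ F
      ≡⟨ trans (⟦⟧-⊗ (x ⊕ y) z F) (⟦⟧-⊕ x y _) ⟩
    ⟦ x ⟧ (λ u → ⟦ z ⟧ (λ v → F (u ++ v))) + ⟦ y ⟧ (λ u → ⟦ z ⟧ (λ v → F (u ++ v)))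
      ≡⟨ sym (trans (⟦⟧-⊕ (x ⊗ z) (y ⊗ z) F) (cong₂ _+_ (⟦⟧-⊗ x z F) (⟦⟧-⊗ y z F))) ⟩
    ⟦ (x ⊗ z) ⊕ (y ⊗ z) ⟧ F ∎
    where open ≡-Reasoning

  ⊗-zeroʳ : ∀ x → x ⊗ zeroE ≈ zeroE
  ⊗-zeroʳ x = free⇒≈ λ F → trans (⟦⟧-⊗ x zeroE F) (⟦⟧-0 x)

  ⊗-identityˡ : ∀ x → oneE ⊗ x ≈ x
  ⊗-identityˡ x = free⇒≈ λ F → begin
    ⟦ oneE ⊗ x ⟧ F        ≡⟨ ⟦⟧-⊗ oneE x F ⟩
    1ℚ * ⟦ x ⟧ F + 0ℚ     ≡⟨ trans (ℚP.+-identityʳ _) (ℚP.*-identityˡ _) ⟩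
    ⟦ x ⟧ F               ∎
    where open ≡-Reasoning

  ·-⊗ : ∀ q x y → (q · x) ⊗ y ≈ q · (x ⊗ y)
  ·-⊗ q x y = free⇒≈ λ F → begin
    ⟦ (q · x) ⊗ y ⟧ F                             ≡⟨ trans (⟦⟧-⊗ (q · x) y F) (⟦⟧-· q x _) ⟩
    q * ⟦ x ⟧ (λ u → ⟦ y ⟧ (λ v → F (u ++ v)))    ≡⟨ cong (q *_) (sym (⟦⟧-⊗ x y F)) ⟩
    q * ⟦ x ⊗ y ⟧ F                               ≡⟨ sym (⟦⟧-· q (x ⊗ y) F) ⟩
    ⟦ q · (x ⊗ y) ⟧ F                             ∎
    where open ≡-Reasoning

  ΣE-cong : {A : Set} (as : List A) {f g : A → Elem n} → (∀ a → f a ≈ g a) → ΣE as f ≈ ΣE as g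
  ΣE-cong [] f≈g = ≈-refl
  ΣE-cong (a ∷ as) f≈g = ⊕-cong (f≈g a) (ΣE-cong as f≈g)

  ΣE-map : {A B : Set} (h : A → B) (as : List A) (f : B → Elem n) → ΣE (map h as) f ≡ ΣE as (λ a → f (h a))
  ΣE-map h [] f = refl
  ΣE-map h (a ∷ as) f = cong (f (h a) ⊕_) (ΣE-map h as f)

  ΣE-++ : {A : Set} (as bs : List A) (f : A → Elem n) → ΣE (as ++ bs) f ≡ ΣE as f ⊕ ΣE bs f
  ΣE-++ [] bs f = refl
  ΣE-++ (a ∷ as) bs f = trans (cong (f a ⊕_) (ΣE-++ as bs f)) (sym (ListP.++-assoc (f a) (ΣE as f) (ΣE bs f)))

  ·-ΣE : {A : Set} (q : ℚ) (as : List A) (f : A → Elem n) → q · ΣE as f ≡ ΣE as (λ a → q · f a)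
  ·-ΣE q [] f = refl
  ·-ΣE q (a ∷ as) f = trans (ListP.map-++ _ (f a) (ΣE as f)) (cong ((q · f a) ⊕_) (·-ΣE q as f))

  ⊗-ΣE : {A : Set} (z : Elem n) (as : List A) (f : A → Elem n) → z ⊗ ΣE as f ≈ ΣE as (λ a → z ⊗ f a)
  ⊗-ΣE z [] f = ⊗-zeroʳ z
  ⊗-ΣE z (a ∷ as) f = ≈-trans (⊗-distribˡ-⊕ z (f a) (ΣE as f)) (⊕-cong ≈-refl (⊗-ΣE z as f))

  ΣE-⊗ : {A : Set} (z : Elem n) (as : List A) (f : A → Elem n) → ΣE as f ⊗ z ≈ ΣE as (λ a → f a ⊗ z)
  ΣE-⊗ z [] f = ≈-refl
  ΣE-⊗ z (a ∷ as) f = ≈-trans (⊗-distribʳ-⊕ z (f a) (ΣE as f)) (⊕-cong ≈-refl (ΣE-⊗ z as f))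

  -- The Orlik–Solomon ideal and the vanishing of long words

  Summand : Set
  Summand = Elem n × RelIx n × Elem n

  summand : Summand → Elem n
  summand (l , r , y) = l ⊗ (rel r ⊗ y)

  InIdeal : Elem n → Set
  InIdeal x = Σ (List Summand) λ ts → x ≈ ΣE ts summand

  InIdeal⇒IsZeroOS : ∀ {x} → InIdeal x → IsZeroOS x
  InIdeal⇒IsZeroOS (ts , x≈) = ts , ≈⇒≈E x≈

  InIdeal-resp : ∀ {x y} → x ≈ y → InIdeal x → InIdeal y
  InIdeal-resp x≈y (ts , x≈) = ts , ≈-trans (≈-sym x≈y) x≈

  InIdeal-zero : ∀ {x} → x ≈ zeroE → InIdeal x
  InIdeal-zero x≈0 = [] , x≈0

  InIdeal-rel : ∀ r y → InIdeal (rel r ⊗ y)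
  InIdeal-rel r y = (oneE , r , y) ∷ [] , (begin
    rel r ⊗ y                        ≈⟨ ⊗-identityˡ (rel r ⊗ y) ⟨
    oneE ⊗ (rel r ⊗ y)               ≡⟨ ListP.++-identityʳ _ ⟨
    (oneE ⊗ (rel r ⊗ y)) ⊕ zeroE     ∎)
    where open ≈-Reasoning

  InIdeal-⊕ : ∀ {x y} → InIdeal x → InIdeal y → InIdeal (x ⊕ y)
  InIdeal-⊕ (ts , x≈) (us , y≈) =
    ts ++ us , ≈-trans (⊕-cong x≈ y≈) (≈-reflexive (sym (ΣE-++ ts us summand)))

  InIdeal-· : ∀ q {x} → InIdeal x → InIdeal (q · x)
  InIdeal-· q {x} (ts , x≈) = map scaleˡ ts , (begin
    q · x                            ≈⟨ ·-cong q x≈ ⟩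
    q · ΣE ts summand                ≡⟨ ·-ΣE q ts summand ⟩
    ΣE ts (λ t → q · summand t)      ≈⟨ ΣE-cong ts (λ { (l , r , y) → ≈-sym (·-⊗ q l (rel r ⊗ y)) }) ⟩
    ΣE ts (λ t → summand (scaleˡ t)) ≡⟨ sym (ΣE-map scaleˡ ts summand) ⟩
    ΣE (map scaleˡ ts) summand       ∎)
    where
    open ≈-Reasoning
    scaleˡ : Summand → Summand
    scaleˡ (l , r , y) = (q · l , r , y)

  InIdeal-⊗ˡ : ∀ z {x} → InIdeal x → InIdeal (z ⊗ x)
  InIdeal-⊗ˡ z {x} (ts , x≈) = map mulˡ ts , (begin
    z ⊗ x                           ≈⟨ ⊗-congˡ z x≈ ⟩
    z ⊗ ΣE ts summand               ≈⟨ ⊗-ΣE z ts summand ⟩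
    ΣE ts (λ t → z ⊗ summand t)     ≈⟨ ΣE-cong ts (λ { (l , r , y) → ⊗-assoc z l (rel r ⊗ y) }) ⟨
    ΣE ts (λ t → summand (mulˡ t))  ≡⟨ sym (ΣE-map mulˡ ts summand) ⟩
    ΣE (map mulˡ ts) summand        ∎)
    where
    open ≈-Reasoning
    mulˡ : Summand → Summand
    mulˡ (l , r , y) = (z ⊗ l , r , y)

  word : Word n → Elem n
  word u = (1ℚ , u) ∷ []

  ⟦word⟧ : ∀ u F → ⟦ word u ⟧ F ≡ F u
  ⟦word⟧ u F = trans (ℚP.+-identityʳ (1ℚ * F u)) (ℚP.*-identityˡ (F u))

  sign : Word n → ℚ
  sign [] = 1ℚ
  sign (_ ∷ w) = - sign w

  Alternating-move : ∀ {F : Word n → ℚ} → Alternating F →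
                     ∀ u y v → F (u ++ y ∷ v) ≡ sign u * F (y ∷ u ++ v)
  Alternating-move alt [] y v = sym (ℚP.*-identityˡ _)
  Alternating-move {F} alt (x ∷ u) y v = begin
    F (x ∷ u ++ y ∷ v)            ≡⟨ Alternating-move (Alternating-suffix (x ∷ []) alt) u y v ⟩
    sign u * F (x ∷ y ∷ u ++ v)   ≡⟨ cong (sign u *_) (swap-adjacent alt [] x y (u ++ v)) ⟩
    sign u * - F (y ∷ x ∷ u ++ v) ≡⟨ sym (ℚP.neg-distribʳ-* (sign u) _) ⟩
    - (sign u * F (y ∷ x ∷ u ++ v)) ≡⟨ ℚP.neg-distribˡ-* (sign u) _ ⟩
    - sign u * F (y ∷ x ∷ u ++ v) ∎
    where open ≡-Reasoning

  Alternating-repeat : ∀ {F : Word n → ℚ} → Alternating F → ∀ y w → F (y ∷ y ∷ w) ≡ 0ℚ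
  Alternating-repeat alt y w = p≡-p⇒p≡0 (swap-adjacent alt [] y y w)

  InIdeal-move : ∀ u y v → InIdeal (word (y ∷ u ++ v)) → InIdeal (word (u ++ y ∷ v))
  InIdeal-move u y v y∷uv∈I = InIdeal-resp moved (InIdeal-· (sign u) y∷uv∈I)
    where
    moved : sign u · word (y ∷ u ++ v) ≈ word (u ++ y ∷ v)
    moved = mk≈ λ F alt → begin
      ⟦ sign u · word (y ∷ u ++ v) ⟧ F    ≡⟨ ⟦⟧-· (sign u) (word (y ∷ u ++ v)) F ⟩
      sign u * ⟦ word (y ∷ u ++ v) ⟧ F    ≡⟨ cong (sign u *_) (⟦word⟧ (y ∷ u ++ v) F) ⟩
      sign u * F (y ∷ u ++ v)             ≡⟨ sym (Alternating-move alt u y v) ⟩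
      F (u ++ y ∷ v)                      ≡⟨ sym (⟦word⟧ (u ++ y ∷ v) F) ⟩
      ⟦ word (u ++ y ∷ v) ⟧ F             ∎
      where open ≡-Reasoning

  InIdeal-∷ : ∀ y {u} → InIdeal (word u) → InIdeal (word (y ∷ u))
  InIdeal-∷ y = InIdeal-⊗ˡ (word (y ∷ []))

  InIdeal-repeat : ∀ y w → InIdeal (word (y ∷ y ∷ w))
  InIdeal-repeat y w = InIdeal-zero (mk≈ λ F alt → trans (⟦word⟧ (y ∷ y ∷ w) F) (Alternating-repeat alt y w))

  InIdeal-swap : ∀ a b w → InIdeal (word (b ∷ a ∷ w)) → InIdeal (word (a ∷ b ∷ w))
  InIdeal-swap a b w = InIdeal-move (a ∷ []) b w

  gen : ∀ {i j : Fin (suc n)} → i Fin.< j → Gen n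
  gen {i} {j} i<j = ((i , j) , i<j)

  e≡word : ∀ {i j} (i<j : i Fin.< j) → e i j ≡ word (gen i<j ∷ [])
  e≡word {i} {j} i<j with i FinP.<? j
  ... | yes i<j′ = cong (λ p → word (gen p ∷ [])) (ℕP.<-irrelevant i<j′ i<j)
  ... | no i≮j = ⊥-elim (i≮j i<j)

  ⟦e⟧ : ∀ {i j} (i<j : i Fin.< j) F → ⟦ e i j ⟧ F ≡ F (gen i<j ∷ [])
  ⟦e⟧ i<j F = trans (cong (λ x → ⟦ x ⟧ F) (e≡word i<j)) (⟦word⟧ _ F)

  ⟦e⊗e⟧ : ∀ {i j k l} (i<j : i Fin.< j) (k<l : k Fin.< l) F →
          ⟦ e i j ⊗ e k l ⟧ F ≡ F (gen i<j ∷ gen k<l ∷ [])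
  ⟦e⊗e⟧ {i} {j} {k} {l} i<j k<l F = begin
    ⟦ e i j ⊗ e k l ⟧ F                               ≡⟨ ⟦⟧-⊗ (e i j) (e k l) F ⟩
    ⟦ e i j ⟧ (λ u → ⟦ e k l ⟧ (λ v → F (u ++ v)))    ≡⟨ ⟦e⟧ i<j _ ⟩
    ⟦ e k l ⟧ (λ v → F (gen i<j ∷ v))                 ≡⟨ ⟦e⟧ k<l _ ⟩
    F (gen i<j ∷ gen k<l ∷ [])                        ∎
    where open ≡-Reasoning

  ⟦rel⟧ : ∀ {i j k} (i<j : i Fin.< j) (j<k : j Fin.< k) (i<k : i Fin.< k) F →
          ⟦ rel ((i , j , k) , i<j , j<k) ⟧ F
            ≡ F (gen i<k ∷ gen j<k ∷ []) + (- 1ℚ * F (gen i<j ∷ gen j<k ∷ []) + F (gen i<j ∷ gen i<k ∷ []))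
  ⟦rel⟧ {i} {j} {k} i<j j<k i<k F = begin
    ⟦ (e i k ⊗ e j k) ⊕ (((- 1ℚ) · (e i j ⊗ e j k)) ⊕ (e i j ⊗ e i k)) ⟧ F
      ≡⟨ ⟦⟧-⊕ (e i k ⊗ e j k) _ F ⟩
    ⟦ e i k ⊗ e j k ⟧ F + ⟦ ((- 1ℚ) · (e i j ⊗ e j k)) ⊕ (e i j ⊗ e i k) ⟧ F
      ≡⟨ cong (⟦ e i k ⊗ e j k ⟧ F +_) (⟦⟧-⊕ ((- 1ℚ) · (e i j ⊗ e j k)) (e i j ⊗ e i k) F) ⟩
    ⟦ e i k ⊗ e j k ⟧ F + (⟦ (- 1ℚ) · (e i j ⊗ e j k) ⟧ F + ⟦ e i j ⊗ e i k ⟧ F)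
      ≡⟨ cong₂ (λ a b → a + (b + ⟦ e i j ⊗ e i k ⟧ F)) (⟦e⊗e⟧ i<k j<k F) (⟦⟧-· (- 1ℚ) (e i j ⊗ e j k) F) ⟩
    F (gen i<k ∷ gen j<k ∷ []) + (- 1ℚ * ⟦ e i j ⊗ e j k ⟧ F + ⟦ e i j ⊗ e i k ⟧ F)
      ≡⟨ cong₂ (λ a b → F (gen i<k ∷ gen j<k ∷ []) + (- 1ℚ * a + b)) (⟦e⊗e⟧ i<j j<k F) (⟦e⊗e⟧ i<j i<k F) ⟩
    F (gen i<k ∷ gen j<k ∷ []) + (- 1ℚ * F (gen i<j ∷ gen j<k ∷ []) + F (gen i<j ∷ gen i<k ∷ [])) ∎
    where open ≡-Reasoning

  InIdeal-triangle : ∀ {i j t} (i<j : i Fin.< j) (j<t : j Fin.< t) (i<t : i Fin.< t) w →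
    InIdeal (word (gen i<j ∷ gen j<t ∷ w)) → InIdeal (word (gen i<j ∷ gen i<t ∷ w)) →
    InIdeal (word (gen i<t ∷ gen j<t ∷ w))
  InIdeal-triangle {i} {j} {t} i<j j<t i<t w ∈I₁ ∈I₂ =
    InIdeal-resp (≈-sym (free⇒≈ expand))
                 (InIdeal-⊕ (InIdeal-rel r (word w)) (InIdeal-⊕ ∈I₁ (InIdeal-· (- 1ℚ) ∈I₂)))
    where
    r : RelIx n
    r = (i , j , t) , i<j , j<t
    ring : ∀ A B C → 1ℚ * A + 0ℚ ≡ (A + (- 1ℚ * B + C)) + (1ℚ * B + ((- 1ℚ * 1ℚ) * C + 0ℚ))
    ring = solve-∀ ℚ-ring
    expand : ∀ F → ⟦ word (gen i<t ∷ gen j<t ∷ w) ⟧ F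
                   ≡ ⟦ (rel r ⊗ word w) ⊕ (word (gen i<j ∷ gen j<t ∷ w) ⊕ ((- 1ℚ) · word (gen i<j ∷ gen i<t ∷ w))) ⟧ F
    expand F = begin
      1ℚ * A + 0ℚ
        ≡⟨ ring A B C ⟩
      (A + (- 1ℚ * B + C)) + rest
        ≡⟨ cong (_+ rest) (sym ⟦rel⊗w⟧) ⟩
      ⟦ rel r ⊗ word w ⟧ F + ⟦ word (gen i<j ∷ gen j<t ∷ w) ⊕ ((- 1ℚ) · word (gen i<j ∷ gen i<t ∷ w)) ⟧ F
        ≡⟨ sym (⟦⟧-⊕ (rel r ⊗ word w) _ F) ⟩
      ⟦ (rel r ⊗ word w) ⊕ (word (gen i<j ∷ gen j<t ∷ w) ⊕ ((- 1ℚ) · word (gen i<j ∷ gen i<t ∷ w))) ⟧ F ∎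
      where
      open ≡-Reasoning
      A = F (gen i<t ∷ gen j<t ∷ w)
      B = F (gen i<j ∷ gen j<t ∷ w)
      C = F (gen i<j ∷ gen i<t ∷ w)
      rest = ⟦ word (gen i<j ∷ gen j<t ∷ w) ⊕ ((- 1ℚ) · word (gen i<j ∷ gen i<t ∷ w)) ⟧ F
      ⟦rel⊗w⟧ : ⟦ rel r ⊗ word w ⟧ F ≡ A + (- 1ℚ * B + C)
      ⟦rel⊗w⟧ = begin
        ⟦ rel r ⊗ word w ⟧ F                         ≡⟨ ⟦⟧-⊗ (rel r) (word w) F ⟩
        ⟦ rel r ⟧ (λ u → ⟦ word w ⟧ (λ v → F (u ++ v))) ≡⟨ ⟦⟧-cong (rel r) (λ u → ⟦word⟧ w (λ v → F (u ++ v))) ⟩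
        ⟦ rel r ⟧ (λ u → F (u ++ w))                 ≡⟨ ⟦rel⟧ i<j j<t i<t (λ u → F (u ++ w)) ⟩
        A + (- 1ℚ * B + C)                           ∎

  InIdeal-common-top : ∀ {t} y y′ w → hi y ≡ t → hi y′ ≡ t →
    (∀ g z → hi g < t → hi z ≡ t → InIdeal (word (g ∷ z ∷ w))) → InIdeal (word (y ∷ y′ ∷ w))
  InIdeal-common-top ((i , t) , i<t) ((j , t′) , j<t′) w refl t′≡t reduce
    with FinP.toℕ-injective t′≡t
  ... | refl with FinP.<-cmp i j
  ...   | tri< i<j _ _ = InIdeal-triangle i<j j<t′ i<t w
                             (reduce (gen i<j) (gen j<t′) j<t′ refl) (reduce (gen i<j) (gen i<t) j<t′ refl)
  ...   | tri> _ _ j<i = InIdeal-swap (gen i<t) (gen j<t′) w (InIdeal-triangle j<i i<t j<t′ w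
                             (reduce (gen j<i) (gen i<t) i<t refl) (reduce (gen j<i) (gen j<t′) i<t refl))
  ...   | tri≈ _ refl _ rewrite ℕP.<-irrelevant j<t′ i<t = InIdeal-repeat (gen i<t) w

  topCount : ℕ → Word n → ℕ
  topCount t [] = 0
  topCount t (g ∷ u) with hi g ℕ.≟ t
  ... | yes _ = suc (topCount t u)
  ... | no _ = topCount t u

  topCount-top : ∀ {t} g u → hi g ≡ t → topCount t (g ∷ u) ≡ suc (topCount t u)
  topCount-top {t} g u g-top with hi g ℕ.≟ t
  ... | yes _ = refl
  ... | no g-not-top = ⊥-elim (g-not-top g-top)

  topCount-other : ∀ {t} g u → hi g ≢ t → topCount t (g ∷ u) ≡ topCount t u
  topCount-other {t} g u g-not-top with hi g ℕ.≟ t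
  ... | yes g-top = ⊥-elim (g-not-top g-top)
  ... | no _ = refl

  record TopSplit (t : ℕ) (u : Word n) (m : ℕ) : Set where
    field
      before after : Word n
      top : Gen n
      splits : u ≡ before ++ top ∷ after
      top-hi : hi top ≡ t
      rest-count : topCount t (before ++ after) ≡ m

    rest : Word n
    rest = before ++ after

    length-rest : length u ≡ suc (length rest)
    length-rest = trans (cong length splits) (ListP.length-++-sucʳ before top after)

    All-rest : ∀ {P : Gen n → Set} → All P u → All P rest
    All-rest Pu with AllP.++⁻ before (subst (All _) splits Pu)
    ... | Pbefore , _ ∷ Pafter = AllP.++⁺ Pbefore Pafter

    InIdeal-top-first : ∀ p → InIdeal (word (top ∷ p ++ rest)) → InIdeal (word (p ++ u))
    InIdeal-top-first p ∈I rewrite splits | sym (ListP.++-assoc p before (top ∷ after)) =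
      InIdeal-move (p ++ before) top after
        (subst (λ v → InIdeal (word (top ∷ v))) (sym (ListP.++-assoc p before after)) ∈I)
  open TopSplit

  splitTop : ∀ t u {m} → topCount t u ≡ suc m → TopSplit t u m
  splitTop t (g ∷ u) {m} count with hi g ℕ.≟ t
  ... | yes g-top = record
    { before = [] ; after = u ; top = g ; splits = refl ; top-hi = g-top ; rest-count = ℕP.suc-injective count }
  ... | no g-not-top = record
    { before = g ∷ before s ; after = after s ; top = top s
    ; splits = cong (g ∷_) (splits s) ; top-hi = top-hi s
    ; rest-count = trans (topCount-other g (rest s) g-not-top) (rest-count s)
    }
    where s = splitTop t u count

  ≤-pred-without-top : ∀ {k} u → topCount (suc k) u ≡ 0 → All (λ g → hi g ≤ suc k) u → All (λ g → hi g ≤ k) u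
  ≤-pred-without-top [] _ [] = []
  ≤-pred-without-top {k} (g ∷ u) none (g≤ ∷ u≤) with hi g ℕ.≟ suc k
  ... | no g-not-top = ℕP.≤-pred (ℕP.≤∧≢⇒< g≤ g-not-top) ∷ ≤-pred-without-top u none u≤

  VanishesAbove : ℕ → Set
  VanishesAbove k = ∀ u → All (λ g → hi g ≤ k) u → k < length u → InIdeal (word u)

  vanishesAbove-zero : VanishesAbove 0
  vanishesAbove-zero (((i , j) , i<j) ∷ u) (j≤0 ∷ _) _ with ℕP.≤-trans i<j j≤0
  ... | ()

  vanishesAbove-suc : ∀ {k} → VanishesAbove k → VanishesAbove (suc k)
  vanishesAbove-suc {k} vanish u bound long = go (topCount (suc k) u) u refl bound long
    where
    go : ∀ m u → topCount (suc k) u ≡ m → All (λ g → hi g ≤ suc k) u → suc k < length u → InIdeal (word u)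
    go zero u none bound long = vanish u (≤-pred-without-top u none bound) (ℕP.<-trans (ℕP.n<1+n k) long)
    go (suc zero) u one bound long = InIdeal-top-first s [] (InIdeal-∷ (top s)
      (vanish (rest s) (≤-pred-without-top (rest s) (rest-count s) (All-rest s bound))
                       (ℕP.≤-pred (subst (suc (suc k) ≤_) (length-rest s) long))))
      where s = splitTop (suc k) u one
    go (suc (suc m)) u many bound long =
      InIdeal-top-first s [] (InIdeal-top-first s′ (top s ∷ [])
        (InIdeal-common-top (top s′) (top s) (rest s′) (top-hi s′) (top-hi s) λ g z g<top z-top →
          go (suc m) (g ∷ z ∷ rest s′) (one-top-fewer g z g<top z-top)
             (ℕP.<⇒≤ g<top ∷ ℕP.≤-reflexive z-top ∷ All-rest s′ (All-rest s bound))
             (subst (suc k <_) (trans (length-rest s) (cong suc (length-rest s′))) long)))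
      where
      s = splitTop (suc k) u many
      s′ = splitTop (suc k) (rest s) (rest-count s)
      one-top-fewer : ∀ g z → hi g < suc k → hi z ≡ suc k → topCount (suc k) (g ∷ z ∷ rest s′) ≡ suc m
      one-top-fewer g z g<top z-top = begin
        topCount (suc k) (g ∷ z ∷ rest s′) ≡⟨ topCount-other g (z ∷ rest s′) (ℕP.<⇒≢ g<top) ⟩
        topCount (suc k) (z ∷ rest s′)     ≡⟨ topCount-top z (rest s′) z-top ⟩
        suc (topCount (suc k) (rest s′))   ≡⟨ cong suc (rest-count s′) ⟩
        suc m                              ∎
        where open ≡-Reasoning

  vanishesAbove : ∀ k → VanishesAbove k
  vanishesAbove zero = vanishesAbove-zero
  vanishesAbove (suc k) = vanishesAbove-suc (vanishesAbove k)

  InIdeal-long-word : ∀ u → n < length u → InIdeal (word u)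
  InIdeal-long-word u = vanishesAbove n u (universal (λ { ((_ , j) , _) → FinP.toℕ≤pred[n] j }) u)

  -- The derivation ∂ with ∂ e_ij = 1

  ∂w : Word n → Elem n
  ∂w [] = zeroE
  ∂w (x ∷ w) = (1ℚ , w) ∷ map (λ { (c , v) → (- c , x ∷ v) }) (∂w w)

  ∂ : Elem n → Elem n
  ∂ [] = zeroE
  ∂ ((c , u) ∷ x) = (c · ∂w u) ⊕ ∂ x

  ∂ᵗ : (Word n → ℚ) → Word n → ℚ
  ∂ᵗ F u = ⟦ ∂w u ⟧ F

  ⟦∂⟧ : ∀ x F → ⟦ ∂ x ⟧ F ≡ ⟦ x ⟧ (∂ᵗ F)
  ⟦∂⟧ [] F = refl
  ⟦∂⟧ ((c , u) ∷ x) F =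
    trans (⟦⟧-⊕ (c · ∂w u) (∂ x) F) (cong₂ _+_ (⟦⟧-· c (∂w u) F) (⟦∂⟧ x F))

  ∂ᵗ-∷ : ∀ x w F → ∂ᵗ F (x ∷ w) ≡ F w - ∂ᵗ (λ v → F (x ∷ v)) w
  ∂ᵗ-∷ x w F = cong₂ _+_ (ℚP.*-identityˡ (F w)) (prefix (∂w w))
    where
    prefix : ∀ y → ⟦ map (λ { (c , v) → (- c , x ∷ v) }) y ⟧ F ≡ - ⟦ y ⟧ (λ v → F (x ∷ v))
    prefix [] = refl
    prefix ((c , v) ∷ y) = trans (cong (λ z → - c * F (x ∷ v) + z) (prefix y)) (ring c (F (x ∷ v)) _)
      where
      ring : ∀ c a b → - c * a + - b ≡ - (c * a + b)
      ring = solve-∀ ℚ-ring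

  Alternating-∂ᵗ : ∀ {F} → Alternating F → Alternating (∂ᵗ F)
  Alternating-∂ᵗ {F} alt = alternating (swap F alt)
    where
    swap : ∀ F → Alternating F → ∀ u a b v → ∂ᵗ F (u ++ a ∷ b ∷ v) ≡ - ∂ᵗ F (u ++ b ∷ a ∷ v)
    swap F alt [] a b v = begin
      ∂ᵗ F (a ∷ b ∷ v)
        ≡⟨ ∂ᵗ-∷∷ a b ⟩
      F (b ∷ v) - (F (a ∷ v) - ∂ᵗ (λ t → F (a ∷ b ∷ t)) v)
        ≡⟨ cong (λ z → F (b ∷ v) - (F (a ∷ v) - z)) (trans (⟦⟧-cong (∂w v) (swap-adjacent alt [] a b))
                                                         (⟦⟧-neg (∂w v) (λ t → F (b ∷ a ∷ t)))) ⟩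
      F (b ∷ v) - (F (a ∷ v) - - ∂ᵗ (λ t → F (b ∷ a ∷ t)) v)
        ≡⟨ ring (F (b ∷ v)) (F (a ∷ v)) (∂ᵗ (λ t → F (b ∷ a ∷ t)) v) ⟩
      - (F (a ∷ v) - (F (b ∷ v) - ∂ᵗ (λ t → F (b ∷ a ∷ t)) v))
        ≡⟨ cong -_ (sym (∂ᵗ-∷∷ b a)) ⟩
      - ∂ᵗ F (b ∷ a ∷ v) ∎
      where
      open ≡-Reasoning
      ring : ∀ B A C → B - (A - - C) ≡ - (A - (B - C))
      ring = solve-∀ ℚ-ring
      ∂ᵗ-∷∷ : ∀ a b → ∂ᵗ F (a ∷ b ∷ v) ≡ F (b ∷ v) - (F (a ∷ v) - ∂ᵗ (λ t → F (a ∷ b ∷ t)) v)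
      ∂ᵗ-∷∷ a b = trans (∂ᵗ-∷ a (b ∷ v) F) (cong (λ z → F (b ∷ v) - z) (∂ᵗ-∷ b v (λ t → F (a ∷ t))))
    swap F alt (x ∷ u) a b v = begin
      ∂ᵗ F (x ∷ u ++ a ∷ b ∷ v)
        ≡⟨ ∂ᵗ-∷ x (u ++ a ∷ b ∷ v) F ⟩
      F (u ++ a ∷ b ∷ v) - ∂ᵗ (λ t → F (x ∷ t)) (u ++ a ∷ b ∷ v)
        ≡⟨ cong₂ _-_ (swap-adjacent alt u a b v)
                     (swap (λ t → F (x ∷ t)) (Alternating-suffix (x ∷ []) alt) u a b v) ⟩
      - F (u ++ b ∷ a ∷ v) - - ∂ᵗ (λ t → F (x ∷ t)) (u ++ b ∷ a ∷ v)
        ≡⟨ ring (F (u ++ b ∷ a ∷ v)) (∂ᵗ (λ t → F (x ∷ t)) (u ++ b ∷ a ∷ v)) ⟩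
      - (F (u ++ b ∷ a ∷ v) - ∂ᵗ (λ t → F (x ∷ t)) (u ++ b ∷ a ∷ v))
        ≡⟨ cong -_ (sym (∂ᵗ-∷ x (u ++ b ∷ a ∷ v) F)) ⟩
      - ∂ᵗ F (x ∷ u ++ b ∷ a ∷ v) ∎
      where
      open ≡-Reasoning
      ring : ∀ A B → - A - - B ≡ - (A - B)
      ring = solve-∀ ℚ-ring

  ∂-cong : ∀ {x y} → x ≈ y → ∂ x ≈ ∂ y
  ∂-cong {x} {y} x≈y = mk≈ λ F alt →
    trans (⟦∂⟧ x F) (trans (agree x≈y (∂ᵗ F) (Alternating-∂ᵗ alt)) (sym (⟦∂⟧ y F)))

  ∂-⊕ : ∀ x y → ∂ (x ⊕ y) ≈ ∂ x ⊕ ∂ y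
  ∂-⊕ x y = free⇒≈ λ F → begin
    ⟦ ∂ (x ⊕ y) ⟧ F                ≡⟨ trans (⟦∂⟧ (x ⊕ y) F) (⟦⟧-⊕ x y (∂ᵗ F)) ⟩
    ⟦ x ⟧ (∂ᵗ F) + ⟦ y ⟧ (∂ᵗ F)    ≡⟨ sym (trans (⟦⟧-⊕ (∂ x) (∂ y) F) (cong₂ _+_ (⟦∂⟧ x F) (⟦∂⟧ y F))) ⟩
    ⟦ ∂ x ⊕ ∂ y ⟧ F                ∎
    where open ≡-Reasoning

  ∂ᵗ-++ : ∀ u v F → ∂ᵗ F (u ++ v) ≡ ∂ᵗ (λ u′ → F (u′ ++ v)) u + sign u * ∂ᵗ (λ v′ → F (u ++ v′)) v
  ∂ᵗ-++ [] v F = sym (trans (ℚP.+-identityˡ _) (ℚP.*-identityˡ _))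
  ∂ᵗ-++ (x ∷ u) v F = begin
    ∂ᵗ F (x ∷ u ++ v)
      ≡⟨ ∂ᵗ-∷ x (u ++ v) F ⟩
    F (u ++ v) - ∂ᵗ (λ t → F (x ∷ t)) (u ++ v)
      ≡⟨ cong (λ z → F (u ++ v) - z) (∂ᵗ-++ u v (λ t → F (x ∷ t))) ⟩
    F (u ++ v) - (∂ᵗ (λ u′ → F (x ∷ u′ ++ v)) u + sign u * ∂ᵗ (λ v′ → F (x ∷ u ++ v′)) v)
      ≡⟨ ring (F (u ++ v)) (∂ᵗ (λ u′ → F (x ∷ u′ ++ v)) u) (sign u) (∂ᵗ (λ v′ → F (x ∷ u ++ v′)) v) ⟩
    (F (u ++ v) - ∂ᵗ (λ u′ → F (x ∷ u′ ++ v)) u) + - sign u * ∂ᵗ (λ v′ → F (x ∷ u ++ v′)) v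
      ≡⟨ cong (_+ - sign u * ∂ᵗ (λ v′ → F (x ∷ u ++ v′)) v) (sym (∂ᵗ-∷ x u (λ u′ → F (u′ ++ v)))) ⟩
    ∂ᵗ (λ u′ → F (u′ ++ v)) (x ∷ u) + - sign u * ∂ᵗ (λ v′ → F (x ∷ u ++ v′)) v ∎
    where
    open ≡-Reasoning
    ring : ∀ A P s Q → A - (P + s * Q) ≡ (A - P) + - s * Q
    ring = solve-∀ ℚ-ring

  involution : Elem n → Elem n
  involution [] = []
  involution ((c , u) ∷ x) = (c * sign u , u) ∷ involution x

  ⟦involution⟧ : ∀ x F → ⟦ involution x ⟧ F ≡ ⟦ x ⟧ (λ u → sign u * F u)
  ⟦involution⟧ [] F = refl
  ⟦involution⟧ ((c , u) ∷ x) F = cong₂ _+_ (ℚP.*-assoc c (sign u) (F u)) (⟦involution⟧ x F)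

  ∂-⊗ : ∀ x y → ∂ (x ⊗ y) ≈ (∂ x ⊗ y) ⊕ (involution x ⊗ ∂ y)
  ∂-⊗ x y = free⇒≈ leibniz
    where
    leibniz : ∀ F → ⟦ ∂ (x ⊗ y) ⟧ F ≡ ⟦ (∂ x ⊗ y) ⊕ (involution x ⊗ ∂ y) ⟧ F
    leibniz F = begin
      ⟦ ∂ (x ⊗ y) ⟧ F
        ≡⟨ trans (⟦∂⟧ (x ⊗ y) F) (⟦⟧-⊗ x y (∂ᵗ F)) ⟩
      ⟦ x ⟧ (λ u → ⟦ y ⟧ (λ v → ∂ᵗ F (u ++ v)))
        ≡⟨ ⟦⟧-cong x (λ u → trans (⟦⟧-cong y (λ v → ∂ᵗ-++ u v F)) (trans (⟦⟧-+ y _ _)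
             (cong (⟦ y ⟧ (λ v → ∂ᵗ (λ u′ → F (u′ ++ v)) u) +_) (⟦⟧-* y (sign u) _)))) ⟩
      ⟦ x ⟧ (λ u → ⟦ y ⟧ (λ v → ∂ᵗ (λ u′ → F (u′ ++ v)) u) + sign u * ⟦ y ⟧ (λ v → ∂ᵗ (λ v′ → F (u ++ v′)) v))
        ≡⟨ ⟦⟧-+ x _ _ ⟩
      ⟦ x ⟧ (λ u → ⟦ y ⟧ (λ v → ∂ᵗ (λ u′ → F (u′ ++ v)) u))
        + ⟦ x ⟧ (λ u → sign u * ⟦ y ⟧ (λ v → ∂ᵗ (λ v′ → F (u ++ v′)) v))
        ≡⟨ cong₂ _+_ differentiate-left differentiate-right ⟩
      ⟦ ∂ x ⊗ y ⟧ F + ⟦ involution x ⊗ ∂ y ⟧ F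
        ≡⟨ sym (⟦⟧-⊕ (∂ x ⊗ y) (involution x ⊗ ∂ y) F) ⟩
      ⟦ (∂ x ⊗ y) ⊕ (involution x ⊗ ∂ y) ⟧ F ∎
      where
      open ≡-Reasoning
      differentiate-left : ⟦ x ⟧ (λ u → ⟦ y ⟧ (λ v → ∂ᵗ (λ u′ → F (u′ ++ v)) u)) ≡ ⟦ ∂ x ⊗ y ⟧ F
      differentiate-left = begin
        ⟦ x ⟧ (λ u → ⟦ y ⟧ (λ v → ∂ᵗ (λ u′ → F (u′ ++ v)) u))
          ≡⟨ ⟦⟧-cong x (λ u → sym (⟦⟧-swap (∂w u) y (λ u′ v → F (u′ ++ v)))) ⟩
        ⟦ x ⟧ (∂ᵗ (λ u′ → ⟦ y ⟧ (λ v → F (u′ ++ v))))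
          ≡⟨ sym (trans (⟦⟧-⊗ (∂ x) y F) (⟦∂⟧ x _)) ⟩
        ⟦ ∂ x ⊗ y ⟧ F ∎
      differentiate-right : ⟦ x ⟧ (λ u → sign u * ⟦ y ⟧ (λ v → ∂ᵗ (λ v′ → F (u ++ v′)) v))
                            ≡ ⟦ involution x ⊗ ∂ y ⟧ F
      differentiate-right = begin
        ⟦ x ⟧ (λ u → sign u * ⟦ y ⟧ (λ v → ∂ᵗ (λ v′ → F (u ++ v′)) v))
          ≡⟨ ⟦⟧-cong x (λ u → cong (sign u *_) (sym (⟦∂⟧ y (λ v′ → F (u ++ v′))))) ⟩
        ⟦ x ⟧ (λ u → sign u * ⟦ ∂ y ⟧ (λ v′ → F (u ++ v′)))
          ≡⟨ sym (trans (⟦⟧-⊗ (involution x) (∂ y) F) (⟦involution⟧ x _)) ⟩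
        ⟦ involution x ⊗ ∂ y ⟧ F ∎

  ∂-rel : ∀ r → ∂ (rel r) ≈ zeroE
  ∂-rel ((i , j , k) , i<j , j<k) = free⇒≈ λ F →
    trans (⟦∂⟧ (rel ((i , j , k) , i<j , j<k)) F)
      (trans (⟦rel⟧ i<j j<k i<k (∂ᵗ F))
        (ring (F (gen i<k ∷ [])) (F (gen j<k ∷ [])) (F (gen i<j ∷ []))))
    where
    i<k = ℕP.<-trans i<j j<k
    ring : ∀ P Q R → (1ℚ * Q + (- 1ℚ * P + 0ℚ))
                     + (- 1ℚ * (1ℚ * Q + (- 1ℚ * R + 0ℚ)) + (1ℚ * P + (- 1ℚ * R + 0ℚ))) ≡ 0ℚ
    ring = solve-∀ ℚ-ring

  involution-rel : ∀ r → involution (rel r) ≈ rel r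
  involution-rel ((i , j , k) , i<j , j<k) = free⇒≈ fixes
    where
    r = (i , j , k) , i<j , j<k
    i<k = ℕP.<-trans i<j j<k
    ring : ∀ A B C → 1ℚ * A + (- 1ℚ * (1ℚ * B) + 1ℚ * C) ≡ A + (- 1ℚ * B + C)
    ring = solve-∀ ℚ-ring
    fixes : ∀ F → ⟦ involution (rel r) ⟧ F ≡ ⟦ rel r ⟧ F
    fixes F = begin
      ⟦ involution (rel r) ⟧ F                 ≡⟨ ⟦involution⟧ (rel r) F ⟩
      ⟦ rel r ⟧ (λ u → sign u * F u)           ≡⟨ ⟦rel⟧ i<j j<k i<k (λ u → sign u * F u) ⟩
      1ℚ * A + (- 1ℚ * (1ℚ * B) + 1ℚ * C)      ≡⟨ ring A B C ⟩
      A + (- 1ℚ * B + C)                       ≡⟨ sym (⟦rel⟧ i<j j<k i<k F) ⟩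
      ⟦ rel r ⟧ F                              ∎
      where
      open ≡-Reasoning
      A = F (gen i<k ∷ gen j<k ∷ [])
      B = F (gen i<j ∷ gen j<k ∷ [])
      C = F (gen i<j ∷ gen i<k ∷ [])

  ∂-ΣE : {A : Set} (as : List A) (f : A → Elem n) → ∂ (ΣE as f) ≈ ΣE as (λ a → ∂ (f a))
  ∂-ΣE [] f = ≈-refl
  ∂-ΣE (a ∷ as) f = ≈-trans (∂-⊕ (f a) (ΣE as f)) (⊕-cong ≈-refl (∂-ΣE as f))

  InIdeal-ΣE : {A : Set} (as : List A) (f : A → Elem n) → (∀ a → InIdeal (f a)) → InIdeal (ΣE as f)
  InIdeal-ΣE [] f _ = InIdeal-zero ≈-refl
  InIdeal-ΣE (a ∷ as) f ∈I = InIdeal-⊕ (∈I a) (InIdeal-ΣE as f ∈I)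

  InIdeal-∂-summand : ∀ t → InIdeal (∂ (summand t))
  InIdeal-∂-summand (l , r , y) = InIdeal-resp (≈-sym leibniz)
    (InIdeal-⊕ (InIdeal-⊗ˡ (∂ l) (InIdeal-rel r y)) (InIdeal-⊗ˡ (involution l) (InIdeal-rel r (∂ y))))
    where
    open ≈-Reasoning
    leibniz : ∂ (l ⊗ (rel r ⊗ y)) ≈ (∂ l ⊗ (rel r ⊗ y)) ⊕ (involution l ⊗ (rel r ⊗ ∂ y))
    leibniz = begin
      ∂ (l ⊗ (rel r ⊗ y))
        ≈⟨ ∂-⊗ l (rel r ⊗ y) ⟩
      (∂ l ⊗ (rel r ⊗ y)) ⊕ (involution l ⊗ ∂ (rel r ⊗ y))
        ≈⟨ ⊕-cong ≈-refl (⊗-congˡ (involution l) (∂-⊗ (rel r) y)) ⟩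
      (∂ l ⊗ (rel r ⊗ y)) ⊕ (involution l ⊗ ((∂ (rel r) ⊗ y) ⊕ (involution (rel r) ⊗ ∂ y)))
        ≈⟨ ⊕-cong ≈-refl (⊗-congˡ (involution l)
             (⊕-cong (⊗-congʳ y (∂-rel r)) (⊗-congʳ (∂ y) (involution-rel r)))) ⟩
      (∂ l ⊗ (rel r ⊗ y)) ⊕ (involution l ⊗ (zeroE ⊕ (rel r ⊗ ∂ y)))
        ≡⟨⟩
      (∂ l ⊗ (rel r ⊗ y)) ⊕ (involution l ⊗ (rel r ⊗ ∂ y)) ∎

  InIdeal-∂ : ∀ {x} → InIdeal x → InIdeal (∂ x)
  InIdeal-∂ (ts , x≈) = InIdeal-resp (≈-sym (≈-trans (∂-cong x≈) (∂-ΣE ts summand)))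
                                     (InIdeal-ΣE ts (λ t → ∂ (summand t)) InIdeal-∂-summand)

  ∂-^E : ∀ {g} → ∂ g ≈ zeroE → ∀ k → ∂ (g ^E k) ≈ zeroE
  ∂-^E ∂g≈0 zero = ≈-refl
  ∂-^E {g} ∂g≈0 (suc k) = begin
    ∂ (g ⊗ (g ^E k))
      ≈⟨ ∂-⊗ g (g ^E k) ⟩
    (∂ g ⊗ (g ^E k)) ⊕ (involution g ⊗ ∂ (g ^E k))
      ≈⟨ ⊕-cong (⊗-congʳ (g ^E k) ∂g≈0) (⊗-congˡ (involution g) (∂-^E ∂g≈0 k)) ⟩
    (zeroE ⊗ (g ^E k)) ⊕ (involution g ⊗ zeroE)
      ≈⟨ ⊗-zeroʳ (involution g) ⟩
    zeroE ∎
    where open ≈-Reasoning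

  ∂-cone : ∀ x {y} → ∂ y ≈ zeroE → ∂ (word (x ∷ []) ⊗ y) ≈ y
  ∂-cone x {y} ∂y≈0 = begin
    ∂ (word (x ∷ []) ⊗ y)    ≈⟨ ∂-⊗ (word (x ∷ [])) y ⟩
    (oneE ⊗ y) ⊕ (x′ ⊗ ∂ y)  ≈⟨ ⊕-cong (⊗-identityˡ y) (⊗-congˡ x′ ∂y≈0) ⟩
    y ⊕ (x′ ⊗ zeroE)         ≈⟨ ⊕-cong (≈-refl {y}) (⊗-zeroʳ x′) ⟩
    y ⊕ zeroE                ≡⟨ ListP.++-identityʳ y ⟩
    y                        ∎
    where
    open ≈-Reasoning
    x′ = involution (word (x ∷ []))

  -- The boundary of g, and degrees

  ⟦ΣE-tabulate⟧ : ∀ {m} {A : Set} (h : Fin m → A) (f : A → Elem n) F →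
                  ⟦ ΣE (tabulate h) f ⟧ F ≡ ∑[ a < m ] ⟦ f (h a) ⟧ F
  ⟦ΣE-tabulate⟧ {zero} h f F = refl
  ⟦ΣE-tabulate⟧ {suc m} h f F =
    trans (⟦⟧-⊕ (f (h Fin.zero)) _ F)
          (cong (⟦ f (h Fin.zero) ⟧ F +_) (⟦ΣE-tabulate⟧ (λ a → h (Fin.suc a)) f F))

  ⟦when⟧ : ∀ b x F → ⟦ when b x ⟧ F ≡ indicator b * ⟦ x ⟧ F
  ⟦when⟧ true x F = sym (ℚP.*-identityˡ (⟦ x ⟧ F))
  ⟦when⟧ false x F = sym (ℚP.*-zeroˡ (⟦ x ⟧ F))

  when-⊗ : ∀ b (x y : Elem n) → when b x ⊗ y ≡ when b (x ⊗ y)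
  when-⊗ true x y = refl
  when-⊗ false x y = refl

  ⊗-when : ∀ b (x y : Elem n) → x ⊗ when b y ≈ when b (x ⊗ y)
  ⊗-when true x y = ≈-refl
  ⊗-when false x y = ⊗-zeroʳ x

  when-cong : ∀ b {x y} → x ≈ y → when b x ≈ when b y
  when-cong true x≈y = x≈y
  when-cong false _ = ≈-refl

  L : Fin (suc n)
  L = last n

  isPair : Fin (suc n) → Fin (suc n) → Bool
  isPair i j = (toℕ i <ᵇ toℕ j) ∧ (toℕ j <ᵇ n)

  below⇒<L : ∀ (k : Fin (suc n)) → T (toℕ k <ᵇ n) → k Fin.< L
  below⇒<L k k<n = subst (λ m → toℕ k < m) (sym (FinP.toℕ-fromℕ n)) (ℕP.<ᵇ⇒< (toℕ k) n k<n)

  isPair⇒< : ∀ i j → T (isPair i j) → i Fin.< j × j Fin.< L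
  isPair⇒< i j ij with Equivalence.to (Bool.T-∧ {toℕ i <ᵇ toℕ j} {toℕ j <ᵇ n}) ij
  ... | i<j , j<n = ℕP.<ᵇ⇒< (toℕ i) (toℕ j) i<j , below⇒<L j j<n

  ⟦e⊗e⟧-∂ᵗ : ∀ {i j k l} (i<j : i Fin.< j) (k<l : k Fin.< l) F →
             ⟦ e i j ⊗ e k l ⟧ (∂ᵗ F) ≡ ⟦ e k l ⟧ F - ⟦ e i j ⟧ F
  ⟦e⊗e⟧-∂ᵗ {i} {j} {k} {l} i<j k<l F = begin
    ⟦ e i j ⊗ e k l ⟧ (∂ᵗ F)                                          ≡⟨ ⟦e⊗e⟧ i<j k<l (∂ᵗ F) ⟩
    1ℚ * F (gen k<l ∷ []) + (- 1ℚ * F (gen i<j ∷ []) + 0ℚ)            ≡⟨ ring (F (gen k<l ∷ [])) (F (gen i<j ∷ [])) ⟩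
    F (gen k<l ∷ []) - F (gen i<j ∷ [])                               ≡⟨ sym (cong₂ _-_ (⟦e⟧ k<l F) (⟦e⟧ i<j F)) ⟩
    ⟦ e k l ⟧ F - ⟦ e i j ⟧ F                                         ∎
    where
    open ≡-Reasoning
    ring : ∀ B A → 1ℚ * B + (- 1ℚ * A + 0ℚ) ≡ B - A
    ring = solve-∀ ℚ-ring

  ⟦ΣE-allFin⟧ : ∀ {m} (f : Fin m → Elem n) F → ⟦ ΣE (allFin m) f ⟧ F ≡ ∑[ a < m ] ⟦ f a ⟧ F
  ⟦ΣE-allFin⟧ = ⟦ΣE-tabulate⟧ (λ a → a)

  ⟦pairs⟧ : ∀ f F → ⟦ pairs f ⟧ F ≡ ∑[ i < suc n ] ∑[ j < suc n ] ⟦ f i j ⟧ F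
  ⟦pairs⟧ f F = trans (⟦ΣE-allFin⟧ (λ i → ΣE (allFin (suc n)) (f i)) F) (sum-cong-≗ (λ i → ⟦ΣE-allFin⟧ (f i) F))

  module ∂g (F : Word n → ℚ) (alt : Alternating F) where

    φ : Fin (suc n) → Fin (suc n) → ℚ
    φ i j = ⟦ e i j ⟧ F

    N M S A : ℚ
    N = ∑[ k < suc n ] below n k
    M = ∑[ k < suc n ] (below n k * φ k L)
    S = ∑[ i < suc n ] ∑[ j < suc n ] pairBelow n i j
    A = ∑[ i < suc n ] ∑[ j < suc n ] (pairBelow n i j * φ i j)

    am-term : Fin (suc n) → Fin (suc n) → Elem n
    am-term i j = when (isPair i j) (ΣE (allFin (suc n)) λ k → when (toℕ k <ᵇ n) (e i j ⊗ e k L))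

    am-expanded : aE n ⊗ mE n ≈ pairs am-term
    am-expanded = begin
      ΣE all (λ i → ΣE all (a-term i)) ⊗ mE n          ≈⟨ ΣE-⊗ (mE n) all (λ i → ΣE all (a-term i)) ⟩
      ΣE all (λ i → ΣE all (a-term i) ⊗ mE n)          ≈⟨ ΣE-cong all (λ i → ΣE-⊗ (mE n) all (a-term i)) ⟩
      ΣE all (λ i → ΣE all (λ j → a-term i j ⊗ mE n))  ≈⟨ ΣE-cong all (λ i → ΣE-cong all (distribute i)) ⟩
      pairs am-term                                    ∎
      where
      open ≈-Reasoning
      all = allFin (suc n)
      a-term : Fin (suc n) → Fin (suc n) → Elem n
      a-term i j = when (isPair i j) (e i j)
      m-term : Fin (suc n) → Elem n
      m-term k = when (toℕ k <ᵇ n) (e k L)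
      distribute : ∀ i j → a-term i j ⊗ mE n ≈ am-term i j
      distribute i j = begin
        when (isPair i j) (e i j) ⊗ mE n                      ≡⟨ when-⊗ (isPair i j) (e i j) (mE n) ⟩
        when (isPair i j) (e i j ⊗ ΣE all m-term)
          ≈⟨ when-cong (isPair i j) (⊗-ΣE (e i j) all m-term) ⟩
        when (isPair i j) (ΣE all (λ k → e i j ⊗ m-term k))
          ≈⟨ when-cong (isPair i j) (ΣE-cong all λ k → ⊗-when (toℕ k <ᵇ n) (e i j) (e k L)) ⟩
        am-term i j ∎

    ∂ᵗ-row : ∀ i j → T (isPair i j) →
             ∑[ k < suc n ] (below n k * ⟦ e i j ⊗ e k L ⟧ (∂ᵗ F)) ≡ 1ℚ * M + - φ i j * N
    ∂ᵗ-row i j ij = begin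
      ∑[ k < suc n ] (below n k * ⟦ e i j ⊗ e k L ⟧ (∂ᵗ F))
        ≡⟨ sum-cong-≗ (λ k → indicator-cong (toℕ k <ᵇ n) λ k<n →
             ⟦e⊗e⟧-∂ᵗ (proj₁ (isPair⇒< i j ij)) (below⇒<L k k<n) F) ⟩
      ∑[ k < suc n ] (below n k * (φ k L - φ i j))
        ≡⟨ sum-cong-≗ (λ k → ring (below n k) (φ k L) (φ i j)) ⟩
      ∑[ k < suc n ] (1ℚ * (below n k * φ k L) + - φ i j * below n k)
        ≡⟨ ∑-linear 1ℚ (- φ i j) (λ k → below n k * φ k L) (below n) ⟩
      1ℚ * M + - φ i j * N ∎
      where
      open ≡-Reasoning
      ring : ∀ b x y → b * (x - y) ≡ 1ℚ * (b * x) + - y * b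
      ring = solve-∀ ℚ-ring

    ∂ᵗ-am : ⟦ aE n ⊗ mE n ⟧ (∂ᵗ F) ≡ M * S + - N * A
    ∂ᵗ-am = begin
      ⟦ aE n ⊗ mE n ⟧ (∂ᵗ F)
        ≡⟨ agree am-expanded (∂ᵗ F) (Alternating-∂ᵗ alt) ⟩
      ⟦ pairs am-term ⟧ (∂ᵗ F)
        ≡⟨ trans (⟦pairs⟧ am-term (∂ᵗ F)) (sum-cong-≗ λ i → sum-cong-≗ λ j → evaluate i j) ⟩
      ∑[ i < suc n ] ∑[ j < suc n ] (pairBelow n i j * ∑[ k < suc n ] (below n k * ⟦ e i j ⊗ e k L ⟧ (∂ᵗ F)))
        ≡⟨ sum-cong-≗ (λ i → sum-cong-≗ λ j → indicator-cong (isPair i j) (∂ᵗ-row i j)) ⟩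
      ∑[ i < suc n ] ∑[ j < suc n ] (pairBelow n i j * (1ℚ * M + - φ i j * N))
        ≡⟨ sum-cong-≗ (λ i → sum-cong-≗ λ j → ring (pairBelow n i j) M (φ i j) N) ⟩
      ∑[ i < suc n ] ∑[ j < suc n ] (M * pairBelow n i j + - N * (pairBelow n i j * φ i j))
        ≡⟨ ∑∑-linear M (- N) (pairBelow n) (λ i j → pairBelow n i j * φ i j) ⟩
      M * S + - N * A ∎
      where
      open ≡-Reasoning
      ring : ∀ b M φ N → b * (1ℚ * M + - φ * N) ≡ M * b + - N * (b * φ)
      ring = solve-∀ ℚ-ring
      evaluate : ∀ i j → ⟦ am-term i j ⟧ (∂ᵗ F)
                         ≡ pairBelow n i j * ∑[ k < suc n ] (below n k * ⟦ e i j ⊗ e k L ⟧ (∂ᵗ F))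
      evaluate i j = begin
        ⟦ am-term i j ⟧ (∂ᵗ F)
          ≡⟨ ⟦when⟧ (isPair i j) (ΣE (allFin (suc n)) λ k → when (toℕ k <ᵇ n) (e i j ⊗ e k L)) (∂ᵗ F) ⟩
        pairBelow n i j * ⟦ ΣE (allFin (suc n)) (λ k → when (toℕ k <ᵇ n) (e i j ⊗ e k L)) ⟧ (∂ᵗ F)
          ≡⟨ cong (pairBelow n i j *_) (⟦ΣE-allFin⟧ (λ k → when (toℕ k <ᵇ n) (e i j ⊗ e k L)) (∂ᵗ F)) ⟩
        pairBelow n i j * ∑[ k < suc n ] ⟦ when (toℕ k <ᵇ n) (e i j ⊗ e k L) ⟧ (∂ᵗ F)
          ≡⟨ cong (pairBelow n i j *_) (sum-cong-≗ λ k → ⟦when⟧ (toℕ k <ᵇ n) (e i j ⊗ e k L) (∂ᵗ F)) ⟩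
        pairBelow n i j * ∑[ k < suc n ] (below n k * ⟦ e i j ⊗ e k L ⟧ (∂ᵗ F)) ∎

    c-term : Fin (suc n) → Fin (suc n) → Elem n
    c-term i j = when (isPair i j) ((e i j ⊗ e i L) ⊕ (e i j ⊗ e j L))

    ∂ᵗ-c : ⟦ cE n ⟧ (∂ᵗ F) ≡ 1ℚ * ((N - 1ℚ) * M) + - (1ℚ + 1ℚ) * A
    ∂ᵗ-c = begin
      ⟦ pairs c-term ⟧ (∂ᵗ F)
        ≡⟨ trans (⟦pairs⟧ c-term (∂ᵗ F)) (sum-cong-≗ λ i → sum-cong-≗ λ j → evaluate i j) ⟩
      ∑[ i < suc n ] ∑[ j < suc n ] (pairBelow n i j * ((φ i L - φ i j) + (φ j L - φ i j)))
        ≡⟨ sum-cong-≗ (λ i → sum-cong-≗ λ j → ring (pairBelow n i j) (φ i L) (φ j L) (φ i j)) ⟩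
      ∑[ i < suc n ] ∑[ j < suc n ]
        (1ℚ * (pairBelow n i j * (φ i L + φ j L)) + - (1ℚ + 1ℚ) * (pairBelow n i j * φ i j))
        ≡⟨ ∑∑-linear 1ℚ (- (1ℚ + 1ℚ)) (λ i j → pairBelow n i j * (φ i L + φ j L)) (λ i j → pairBelow n i j * φ i j) ⟩
      1ℚ * ∑[ i < suc n ] ∑[ j < suc n ] (pairBelow n i j * (φ i L + φ j L)) + - (1ℚ + 1ℚ) * A
        ≡⟨ cong (λ z → 1ℚ * z + - (1ℚ + 1ℚ) * A) (∑-pairBelow n (λ k → φ k L)) ⟩
      1ℚ * ((N - 1ℚ) * M) + - (1ℚ + 1ℚ) * A ∎
      where
      open ≡-Reasoning
      ring : ∀ b x y z → b * ((x - z) + (y - z)) ≡ 1ℚ * (b * (x + y)) + - (1ℚ + 1ℚ) * (b * z)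
      ring = solve-∀ ℚ-ring
      evaluate : ∀ i j → ⟦ c-term i j ⟧ (∂ᵗ F) ≡ pairBelow n i j * ((φ i L - φ i j) + (φ j L - φ i j))
      evaluate i j = begin
        ⟦ c-term i j ⟧ (∂ᵗ F)
          ≡⟨ ⟦when⟧ (isPair i j) ((e i j ⊗ e i L) ⊕ (e i j ⊗ e j L)) (∂ᵗ F) ⟩
        pairBelow n i j * ⟦ (e i j ⊗ e i L) ⊕ (e i j ⊗ e j L) ⟧ (∂ᵗ F)
          ≡⟨ cong (pairBelow n i j *_) (⟦⟧-⊕ (e i j ⊗ e i L) (e i j ⊗ e j L) (∂ᵗ F)) ⟩
        pairBelow n i j * (⟦ e i j ⊗ e i L ⟧ (∂ᵗ F) + ⟦ e i j ⊗ e j L ⟧ (∂ᵗ F))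
          ≡⟨ indicator-cong (isPair i j) (λ ij → let i<j , j<L = isPair⇒< i j ij in
               cong₂ _+_ (⟦e⊗e⟧-∂ᵗ i<j (ℕP.<-trans i<j j<L) F) (⟦e⊗e⟧-∂ᵗ i<j j<L F)) ⟩
        pairBelow n i j * ((φ i L - φ i j) + (φ j L - φ i j)) ∎

    S≡ : S ≡ ½ * ((N - 1ℚ) * N)
    S≡ = begin
      S                                                            ≡⟨ p≡½[p+p] S ⟩
      ½ * (S + S)                                                  ≡⟨ cong (½ *_) (sym doubled) ⟩
      ½ * ∑[ i < suc n ] ∑[ j < suc n ] (pairBelow n i j * (1ℚ + 1ℚ))
        ≡⟨ cong (½ *_) (∑-pairBelow {suc n} n (λ _ → 1ℚ)) ⟩
      ½ * ((N - 1ℚ) * ∑[ k < suc n ] (below n k * 1ℚ))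
        ≡⟨ cong (λ z → ½ * ((N - 1ℚ) * z)) (sum-cong-≗ {suc n} λ k → ℚP.*-identityʳ (below n k)) ⟩
      ½ * ((N - 1ℚ) * N)                                           ∎
      where
      open ≡-Reasoning
      ring : ∀ b → b * (1ℚ + 1ℚ) ≡ 1ℚ * b + 1ℚ * b
      ring = solve-∀ ℚ-ring
      row : ∀ (i : Fin (suc n)) → ∑[ j < suc n ] (pairBelow n i j * (1ℚ + 1ℚ))
                                 ≡ ∑[ j < suc n ] (1ℚ * pairBelow n i j + 1ℚ * pairBelow n i j)
      row i = sum-cong-≗ λ j → ring (pairBelow n i j)
      doubled : ∑[ i < suc n ] ∑[ j < suc n ] (pairBelow n i j * (1ℚ + 1ℚ)) ≡ S + S
      doubled = trans (sum-cong-≗ row) (trans (∑∑-linear {suc n} 1ℚ 1ℚ (pairBelow n) (pairBelow n))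
                                              (cong₂ _+_ (ℚP.*-identityˡ S) (ℚP.*-identityˡ S)))

  ∂gE≈0 : n ≡ pOf n ℕ.+ pOf n → ∂ (gE n) ≈ zeroE
  ∂gE≈0 even = mk≈ vanishes
    where
    p = fromℕ (pOf n)
    ring : ∀ M A p → (M * (½ * (((p + p) - 1ℚ) * (p + p))) + - (p + p) * A)
                     + - p * (1ℚ * (((p + p) - 1ℚ) * M) + - (1ℚ + 1ℚ) * A) ≡ 0ℚ
    ring = solve-∀ ℚ-ring
    vanishes : ∀ F → Alternating F → ⟦ ∂ (gE n) ⟧ F ≡ 0ℚ
    vanishes F alt = begin
      ⟦ ∂ (gE n) ⟧ F
        ≡⟨ trans (⟦∂⟧ (gE n) F) (⟦⟧-⊕ (aE n ⊗ mE n) ((- p) · cE n) (∂ᵗ F)) ⟩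
      ⟦ aE n ⊗ mE n ⟧ (∂ᵗ F) + ⟦ (- p) · cE n ⟧ (∂ᵗ F)
        ≡⟨ cong₂ _+_ ∂ᵗ-am (trans (⟦⟧-· (- p) (cE n) (∂ᵗ F)) (cong (- p *_) ∂ᵗ-c)) ⟩
      (M * S + - N * A) + - p * (1ℚ * ((N - 1ℚ) * M) + - (1ℚ + 1ℚ) * A)
        ≡⟨ cong (λ S → (M * S + - N * A) + - p * (1ℚ * ((N - 1ℚ) * M) + - (1ℚ + 1ℚ) * A)) S≡ ⟩
      (M * (½ * ((N - 1ℚ) * N)) + - N * A) + - p * (1ℚ * ((N - 1ℚ) * M) + - (1ℚ + 1ℚ) * A)
        ≡⟨ cong (λ N → (M * (½ * ((N - 1ℚ) * N)) + - N * A) + - p * (1ℚ * ((N - 1ℚ) * M) + - (1ℚ + 1ℚ) * A)) N≡p+p ⟩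
      (M * (½ * (((p + p) - 1ℚ) * (p + p))) + - (p + p) * A)
        + - p * (1ℚ * (((p + p) - 1ℚ) * M) + - (1ℚ + 1ℚ) * A)
        ≡⟨ ring M A p ⟩
      0ℚ ∎
      where
      open ≡-Reasoning
      open ∂g F alt
      N≡p+p : N ≡ p + p
      N≡p+p = trans (∑-below (suc n) n (ℕP.n≤1+n n)) (trans (cong fromℕ even) (fromℕ-+ (pOf n) (pOf n)))

  AtLeastDegree : ℕ → Elem n → Set
  AtLeastDegree d = All (λ term → d ≤ length (proj₂ term))

  degree-⊕ : ∀ {d x y} → AtLeastDegree d x → AtLeastDegree d y → AtLeastDegree d (x ⊕ y)
  degree-⊕ = AllP.++⁺

  degree-· : ∀ {d} q {x} → AtLeastDegree d x → AtLeastDegree d (q · x)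
  degree-· q = AllP.map⁺

  degree-⊗ : ∀ {d₁ d₂ x y} → AtLeastDegree d₁ x → AtLeastDegree d₂ y → AtLeastDegree (d₁ ℕ.+ d₂) (x ⊗ y)
  degree-⊗ {y = y} x≥ y≥ = AllP.concat⁺ (AllP.map⁺ (All.map (λ {(_ , u)} u≥ →
    AllP.map⁺ (All.map (λ v≥ → subst (_ ≤_) (sym (ListP.length-++ u)) (ℕP.+-mono-≤ u≥ v≥)) y≥)) x≥))

  degree-ΣE : ∀ {d} {A : Set} (as : List A) (f : A → Elem n) →
              (∀ a → AtLeastDegree d (f a)) → AtLeastDegree d (ΣE as f)
  degree-ΣE [] f _ = []
  degree-ΣE (a ∷ as) f f≥ = degree-⊕ (f≥ a) (degree-ΣE as f f≥)

  degree-pairs : ∀ {d} f → (∀ i j → AtLeastDegree d (f i j)) → AtLeastDegree d (pairs f)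
  degree-pairs f f≥ = degree-ΣE (allFin (suc n)) _ λ i → degree-ΣE (allFin (suc n)) (f i) (f≥ i)

  degree-when : ∀ {d} b {x} → AtLeastDegree d x → AtLeastDegree d (when b x)
  degree-when true x≥ = x≥
  degree-when false _ = []

  degree-e : ∀ i j → AtLeastDegree 1 (e i j)
  degree-e i j with i FinP.<? j
  ... | yes _ = s≤s z≤n ∷ []
  ... | no _ = []

  degree-gE : AtLeastDegree 2 (gE n)
  degree-gE = degree-⊕ (degree-⊗ degree-aE degree-mE) (degree-· (- fromℕ (pOf n)) degree-cE)
    where
    degree-aE : AtLeastDegree 1 (aE n)
    degree-aE = degree-pairs _ λ i j → degree-when (isPair i j) (degree-e i j)
    degree-mE : AtLeastDegree 1 (mE n)
    degree-mE = degree-ΣE (allFin (suc n)) _ λ k → degree-when (toℕ k <ᵇ n) (degree-e k L)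
    degree-cE : AtLeastDegree 2 (cE n)
    degree-cE = degree-pairs _ λ i j → degree-when (isPair i j)
      (degree-⊕ (degree-⊗ (degree-e i j) (degree-e i L)) (degree-⊗ (degree-e i j) (degree-e j L)))

  degree-^E : ∀ {g} → AtLeastDegree 2 g → ∀ k → AtLeastDegree (k ℕ.+ k) (g ^E k)
  degree-^E g≥ zero = z≤n ∷ []
  degree-^E {g} g≥ (suc k) = subst (λ d → AtLeastDegree d (g ^E suc k)) (cong suc (sym (ℕP.+-suc k k)))
                                   (degree-⊗ g≥ (degree-^E g≥ k))

  InIdeal-high-degree : ∀ {x} → AtLeastDegree (suc n) x → InIdeal x
  InIdeal-high-degree [] = InIdeal-zero ≈-refl
  InIdeal-high-degree {(c , u) ∷ x} (u-long ∷ x≥) =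
    InIdeal-resp split (InIdeal-⊕ (InIdeal-· c (InIdeal-long-word u u-long)) (InIdeal-high-degree x≥))
    where
    split : (c · word u) ⊕ x ≈ (c , u) ∷ x
    split = free⇒≈ λ F → cong (λ a → a * F u + ⟦ x ⟧ F) (ℚP.*-identityʳ c)

  InIdeal-∂-closed : ∀ {y} → Gen n → ∂ y ≈ zeroE → AtLeastDegree n y → InIdeal y
  InIdeal-∂-closed {y} x ∂y≈0 y≥ =
    InIdeal-resp (∂-cone x ∂y≈0) (InIdeal-∂ (InIdeal-high-degree (degree-⊗ {x = word (x ∷ [])} (s≤s z≤n ∷ []) y≥)))

  InIdeal-gE^pOf : Gen n → InIdeal (gE n ^E pOf n)
  InIdeal-gE^pOf x with pOf-parity n | degree-^E degree-gE (pOf n)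
  ... | inj₁ even | g^p≥ = InIdeal-∂-closed x (∂-^E (∂gE≈0 even) (pOf n))
                             (subst (λ d → AtLeastDegree d (gE n ^E pOf n)) (sym even) g^p≥)
  ... | inj₂ odd | g^p≥ = InIdeal-high-degree (subst (λ d → AtLeastDegree d (gE n ^E pOf n)) (sym odd) g^p≥)

lemma6p4 : (n : ℕ) → 2 ≤ n → IsZeroOS (gE n ^E pOf n)
lemma6p4 n@(suc (suc _)) (s≤s (s≤s z≤n)) = InIdeal⇒IsZeroOS (InIdeal-gE^pOf e₁₂)
  where
  open OrlikSolomon n
  e₁₂ : Gen n
  e₁₂ = (Fin.zero , Fin.suc Fin.zero) , s≤s z≤n
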